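{- Let $h$ be a positive integer. If $\sigma(x^{2h})$ and $\sigma((x+1)^{2h})$ factor in $\mathcal{F}$, then $h\in\{1,2,3,4,6,7\}$. In these cases, $\sigma(x^2)=\sigma((x+1)^2)=M_1$, $\sigma(x^4)=M_4$, $\sigma((x+1)^4)=M_5$, $\sigma(x^6)=\sigma((x+1)^6)=M_2M_3$, $\sigma(x^8)=M_1S_4$, $\sigma((x+1)^8)=M_1S_5$, $\sigma(x^{12})=S_3$, $\sigma((x+1)^{12})=S_6$, $\sigma(x^{14})=\sigma((x+1)^{14})=M_1M_4M_5S_1$.
   Context: All polynomials are in $\mathbb{F}_2[x]$; $\sigma(A)$ is the sum of all divisors of $A$, so $\sigma(x^{2h})=1+x+\cdots+x^{2h}$. A polynomial factors in $\mathcal{F}$ if all its irreducible factors belong to $\mathcal{F}$. $\overline{T}(x):=T(x+1)$; for $Q$ and positive integers $a,b,c$, $Q^{abc}:=1+x^a(x+1)^bQ^c$. $\mathcal{F}=\{M_1,\ldots,M_{13},S_1,\ldots,S_{15}\}$ where $M_1=1+x+x^2$, $M_2=1+x+x^3$, $M_3=1+x^2+x^3$, $M_4=1+x+x^2+x^3+x^4$, $M_5=1+x^3+x^4$, $M_6=1+x^3+x^5$, $M_7=1+x^3+x^7$, $M_8=1+x^6+x^7$, $M_9=\overline{M_6}$, $M_{10}=\overline{M_7}$, $M_{11}=\overline{M_8}$, $M_{12}=x^9+x+1$, $M_{13}=x^9+x^8+1$; $S_1=M_1^{111}$, $S_2=M_1^{221}$, $S_3=M_1^{134}$, $S_4=M_1^{311}$,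 $S_5=M_1^{131}$, $S_6=M_1^{314}$, $S_7=M_1^{113}$, $S_8=M_1^{331}$, $S_9=M_1^{115}$, $S_{10}=M_1^{411}$, $S_{11}=M_1^{121}$, $S_{12}=M_1^{212}$, $S_{13}=M_1^{141}$, $S_{14}=M_1^{211}$, $S_{15}=M_1^{122}$. -}

module Defs where

open import Data.Bool using (Bool; true; false; _xor_; if_then_else_)
open import Data.Nat using (ℕ; zero; suc; _≤_)
open import Data.List using (List; []; _∷_; length; filter; foldr; concatMap; map)
open import Data.List.Relation.Unary.Any using (Any; any?)
open import Data.List.Properties using (≡-dec)
open import Data.Product using (Σ; _×_; _,_)
open import Data.Sum using (_⊎_)
import Data.Bool.Properties as BoolP
open import Relation.Binary.PropositionalEquality using (_≡_)
open import Relation.Nullary using (Dec)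

-- Polynomials over F₂ as coefficient lists, lowest degree first.
-- Trailing zero coefficients are allowed; equality is taken up to them.

Poly : Set
Poly = List Bool

norm : Poly → Poly
norm [] = []
norm (b ∷ p) with norm p
... | [] = if b then true ∷ [] else []
... | c ∷ q = b ∷ c ∷ q

infix 4 _≈_
_≈_ : Poly → Poly → Set
p ≈ q = norm p ≡ norm q

_≈?_ : (p q : Poly) → Dec (p ≈ q)
p ≈? q = ≡-dec BoolP._≟_ (norm p) (norm q)

infixl 6 _⊕_
_⊕_ : Poly → Poly → Poly
[] ⊕ q = q
(a ∷ p) ⊕ [] = a ∷ p
(a ∷ p) ⊕ (b ∷ q) = (a xor b) ∷ (p ⊕ q)

infixl 7 _⊗_
_⊗_ : Poly → Poly → Poly
[] ⊗ q = []
(false ∷ p) ⊗ q = false ∷ (p ⊗ q)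
(true ∷ p) ⊗ q = q ⊕ (false ∷ (p ⊗ q))

one : Poly
one = true ∷ []

X : Poly
X = false ∷ true ∷ []

X+1 : Poly
X+1 = true ∷ true ∷ []

_^^_ : Poly → ℕ → Poly
p ^^ zero = one
p ^^ suc n = p ⊗ (p ^^ n)

compose : Poly → Poly → Poly
compose [] q = []
compose (b ∷ p) q = (b ∷ []) ⊕ (q ⊗ compose p q)

bar : Poly → Poly
bar p = compose p X+1

Qabc : Poly → ℕ → ℕ → ℕ → Poly
Qabc Q a b c = one ⊕ ((X ^^ a) ⊗ ((X+1 ^^ b) ⊗ (Q ^^ c)))

-- size p = 1 + degree p  (size of zero polynomial is 0)
size : Poly → ℕ
size p = length (norm p)

infix 4 _∣_
_∣_ : Poly → Poly → Set
d ∣ a = Σ Poly λ c → c ⊗ d ≈ a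

-- irreducible: non-constant, and any factorisation has a constant
-- (i.e. unit, the only nonzero constant being 1) factor
Irreducible : Poly → Set
Irreducible p = (2 ≤ size p) ×
  ((a b : Poly) → a ⊗ b ≈ p → (size a ≡ 1) ⊎ (size b ≡ 1))

FactorsIn : List Poly → Poly → Set
FactorsIn 𝓕 a = (p : Poly) → Irreducible p → p ∣ a → Any (λ q → p ≈ q) 𝓕

-- σ(A): the sum of all divisors of A.
-- polysOfLength n enumerates every polynomial of degree < n exactly once.

polysOfLength : ℕ → List Poly
polysOfLength zero = [] ∷ []
polysOfLength (suc n) = concatMap (λ p → (false ∷ p) ∷ (true ∷ p) ∷ []) (polysOfLength n)

-- decidable divisibility for a ≠ 0: any quotient has degree ≤ deg a,
-- so it suffices to search quotients of size ≤ size a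
divides? : (a d : Poly) → Dec (Any (λ c → c ⊗ d ≈ a) (polysOfLength (size a)))
divides? a d = any? (λ c → (c ⊗ d) ≈? a) (polysOfLength (size a))

divisors : Poly → List Poly
divisors a = filter (divides? a) (polysOfLength (size a))

σ : Poly → Poly
σ a = foldr _⊕_ [] (divisors a)

M1 M2 M3 M4 M5 M6 M7 M8 M9 M10 M11 M12 M13 : Poly
M1 = true ∷ true ∷ true ∷ []
M2 = true ∷ true ∷ false ∷ true ∷ []
M3 = true ∷ false ∷ true ∷ true ∷ []
M4 = true ∷ true ∷ true ∷ true ∷ true ∷ []
M5 = true ∷ false ∷ false ∷ true ∷ true ∷ []
M6 = true ∷ false ∷ false ∷ true ∷ false ∷ true ∷ []
M7 = true ∷ false ∷ false ∷ true ∷ false ∷ false ∷ false ∷ true ∷ []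
M8 = true ∷ false ∷ false ∷ false ∷ false ∷ false ∷ true ∷ true ∷ []
M9 = bar M6
M10 = bar M7
M11 = bar M8
M12 = true ∷ true ∷ false ∷ false ∷ false ∷ false ∷ false ∷ false ∷ false ∷ true ∷ []
M13 = true ∷ false ∷ false ∷ false ∷ false ∷ false ∷ false ∷ false ∷ true ∷ true ∷ []

S1 S2 S3 S4 S5 S6 S7 S8 S9 S10 S11 S12 S13 S14 S15 : Poly
S1 = Qabc M1 1 1 1
S2 = Qabc M1 2 2 1
S3 = Qabc M1 1 3 4
S4 = Qabc M1 3 1 1
S5 = Qabc M1 1 3 1
S6 = Qabc M1 3 1 4
S7 = Qabc M1 1 1 3
S8 = Qabc M1 3 3 1
S9 = Qabc M1 1 1 5
S10 = Qabc M1 4 1 1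
S11 = Qabc M1 1 2 1
S12 = Qabc M1 2 1 2
S13 = Qabc M1 1 4 1
S14 = Qabc M1 2 1 1
S15 = Qabc M1 1 2 2

𝓕 : List Poly
𝓕 = M1 ∷ M2 ∷ M3 ∷ M4 ∷ M5 ∷ M6 ∷ M7 ∷ M8 ∷ M9 ∷ M10 ∷ M11 ∷ M12 ∷ M13 ∷
    S1 ∷ S2 ∷ S3 ∷ S4 ∷ S5 ∷ S6 ∷ S7 ∷ S8 ∷ S9 ∷ S10 ∷ S11 ∷ S12 ∷ S13 ∷ S14 ∷ S15 ∷ []

module Submission where

-- The divisors of (x + ρ)ᵐ over 𝔽₂ are the powers (x + ρ)ᵏ with k ≤ m, so σ((x + ρ)ᵐ) is
-- Σ_{k≤m} (x + ρ)ᵏ: the listed values are then computations, and σ(x²ʰ) is the repunit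
-- Rₙ = 1 + x + ⋯ + xⁿ⁻¹ with n = 2h + 1.  Call n good if every irreducible factor of Rₙ lies
-- in 𝓕; as R_d ∣ Rₙ for d ∣ n, divisors of good numbers are good.  No prime p outside
-- {2, 3, 5, 7, 13, 17, 31, 73, 127} divides a good n: each member of 𝓕 divides some xᵉ + 1
-- with p ∤ e, so an irreducible factor of R_p in 𝓕 would divide x^gcd(p,e) + 1 = x + 1, which
-- is prime to R_p for odd p.  For d = 2, 17, 31, 73, 127, 21, 25, 27, 35, 39, 45, 49, 65, 91,
-- 169, R_d has a nonconstant factor coprime to all of 𝓕, found and checked by computation, so
-- d divides no good n.  The good odd n that remain are 1, 3, 5, 7, 9, 13 and 15.

open import Defs
open import Algebra.Bundles using (CommutativeRing; CommutativeSemigroup)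
import Algebra.Properties.CommutativeSemigroup as CommSemigroupProperties
open import Data.Bool using (Bool; true; false; T; _xor_; _∧_; _∨_; if_then_else_)
import Data.Bool as Bool
open import Data.Bool.Properties
  using ( xor-assoc; xor-comm; xor-same; xor-identityʳ; xor-∧-commutativeRing
        ; ∧-distribˡ-xor; ∧-distribʳ-xor; ∧-assoc; ∧-zeroʳ; ∧-identityʳ; not-involutive)
open import Data.Empty using (⊥-elim)
open import Data.List
  using (List; []; _∷_; length; filter; foldr; concatMap; _++_; replicate; take)
open import Data.List.Properties using (≡-dec; ∷-injectiveʳ; length-++; length-replicate)
import Data.List.Membership.DecPropositional
open import Data.List.Membership.Propositional using (_∈_; _∉_; lose; find)
open import Data.List.Membership.Propositional.Properties using (∈-concatMap⁻; ∈-concatMap⁺)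
open import Data.List.Relation.Unary.All as All using (All; []; _∷_; all?)
open import Data.List.Relation.Unary.All.Properties using (All¬⇒¬Any)
open import Data.List.Relation.Unary.AllPairs using ([]; _∷_)
open import Data.List.Relation.Unary.Any using (Any; any?; here; there)
open import Data.List.Relation.Unary.Unique.Propositional using (Unique)
open import Data.Nat
  using (ℕ; zero; suc; _+_; _*_; _∸_; _≤_; _<_; _≤?_; _<?_; z≤n; s≤s)
open import Data.Nat.Coprimality using (Coprime; coprime-Bézout)
open import Data.Nat.Divisibility using (divides; ∣1⇒≡1; m∣m*n; n∣m*n) renaming (_∣_ to _∣ₙ_)
open import Data.Nat.GCD using (module Bézout)
open import Data.Nat.ListAction using (product)
open import Data.Nat.Primality
  using (Prime; prime?; euclidsLemma; prime⇒irreducible; ¬prime[0]; ¬prime[1])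
open import Data.Nat.Primality.Factorisation using (factorise; PrimeFactorisation)
open import Data.Nat.Properties
  using ( _≟_; ≤-refl; ≤-reflexive; ≤-antisym; ≤-trans; ≤-pred; <-≤-trans; <⇒≤; <⇒≱; ≰⇒>
        ; ≤∧≢⇒<; <-irrefl; n≤1+n; m≤n⇒m≤1+n; m≤n+m; m<n+m; n≢0⇒n>0; m+n≡0⇒n≡0
        ; m+[n∸m]≡n; m∸n≤m; m∸n+n≡m; +-comm; *-cancelˡ-≡; suc-injective)
open import Data.Product using (Σ-syntax; _×_; _,_; proj₁; proj₂)
open import Data.Sum using (_⊎_; inj₁; inj₂)
open import Function using (_∘_; _⇔_; mk⇔; case_of_)
open import Level using (0ℓ)
open import Relation.Binary.Bundles using (Setoid)
open import Relation.Binary.Definitions using (DecidableEquality)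
open import Relation.Binary.PropositionalEquality
import Relation.Binary.Reasoning.Setoid as SetoidReasoning
open import Relation.Nullary using (¬_; Dec; does; yes; no)
open import Relation.Nullary.Decidable using (toWitness; does-⇔; dec-false; _×-dec_)
open import Relation.Unary using (Decidable)

coeff : Poly → ℕ → Bool
coeff []      i       = false
coeff (b ∷ p) zero    = b
coeff (b ∷ p) (suc i) = coeff p i

normCons : Bool → Poly → Poly
normCons b []      = if b then true ∷ [] else []
normCons b (c ∷ q) = b ∷ c ∷ q

norm-∷ : ∀ b p → norm (b ∷ p) ≡ normCons b (norm p)
norm-∷ b p with norm p
... | []    = refl
... | c ∷ q = refl

coeff-normCons : ∀ b p i → coeff (normCons b p) i ≡ coeff (b ∷ p) i
coeff-normCons true  []      zero    = refl
coeff-normCons true  []      (suc i) = refl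
coeff-normCons false []      zero    = refl
coeff-normCons false []      (suc i) = refl
coeff-normCons b     (c ∷ q) i       = refl

coeff-norm : ∀ p i → coeff (norm p) i ≡ coeff p i
coeff-norm []      i       = refl
coeff-norm (b ∷ p) i       rewrite norm-∷ b p = trans (coeff-normCons b (norm p) i) (step i)
  where
  step : ∀ i → coeff (b ∷ norm p) i ≡ coeff (b ∷ p) i
  step zero    = refl
  step (suc i) = coeff-norm p i

-- _≈_ wrapped in a record, so that Agda can infer the polynomials from an equation.
infix 4 _≃_
record _≃_ (p q : Poly) : Set where
  constructor mk≃
  field ≃⇒≈ : p ≈ q
open _≃_ public

≃-refl : ∀ {p} → p ≃ p
≃-refl = mk≃ refl

≃-sym : ∀ {p q} → p ≃ q → q ≃ p
≃-sym (mk≃ e) = mk≃ (sym e)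

≃-trans : ∀ {p q r} → p ≃ q → q ≃ r → p ≃ r
≃-trans (mk≃ e) (mk≃ f) = mk≃ (trans e f)

≃-reflexive : ∀ {p q} → p ≡ q → p ≃ q
≃-reflexive refl = ≃-refl

≃-setoid : Setoid 0ℓ 0ℓ
≃-setoid = record
  { Carrier = Poly ; _≈_ = _≃_
  ; isEquivalence = record { refl = ≃-refl ; sym = ≃-sym ; trans = ≃-trans } }

module ≃-Reasoning = SetoidReasoning ≃-setoid

coeff-cong : ∀ {p q} → p ≃ q → ∀ i → coeff p i ≡ coeff q i
coeff-cong {p} {q} (mk≃ p≈q) i =
  trans (sym (coeff-norm p i)) (trans (cong (λ r → coeff r i) p≈q) (coeff-norm q i))

coeff-ext : ∀ {p q} → (∀ i → coeff p i ≡ coeff q i) → p ≃ q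
coeff-ext {p} {q} eq = mk≃ (go p q eq)
  where
  go : ∀ p q → (∀ i → coeff p i ≡ coeff q i) → p ≈ q
  go []      []      _  = refl
  go []      (b ∷ q) eq =
    trans (cong₂ normCons (eq zero) (go [] q (λ i → eq (suc i)))) (sym (norm-∷ b q))
  go (a ∷ p) []      eq =
    trans (norm-∷ a p) (cong₂ normCons (eq zero) (go p [] (λ i → eq (suc i))))
  go (a ∷ p) (b ∷ q) eq =
    trans (norm-∷ a p) (trans (cong₂ normCons (eq zero) (go p q (λ i → eq (suc i))))
                              (sym (norm-∷ b q)))

∷-cong : ∀ b {p q} → p ≃ q → b ∷ p ≃ b ∷ q
∷-cong b {p} {q} (mk≃ p≈q) =
  mk≃ (trans (norm-∷ b p) (trans (cong (normCons b) p≈q) (sym (norm-∷ b q))))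

coeff-⊕ : ∀ p q i → coeff (p ⊕ q) i ≡ coeff p i xor coeff q i
coeff-⊕ []      q       i       = refl
coeff-⊕ (a ∷ p) []      zero    = sym (xor-identityʳ a)
coeff-⊕ (a ∷ p) []      (suc i) = sym (xor-identityʳ (coeff p i))
coeff-⊕ (a ∷ p) (b ∷ q) zero    = refl
coeff-⊕ (a ∷ p) (b ∷ q) (suc i) = coeff-⊕ p q i

⊕-cong : ∀ {p p' q q'} → p ≃ p' → q ≃ q' → p ⊕ q ≃ p' ⊕ q'
⊕-cong {p} {p'} {q} {q'} p≃p' q≃q' = coeff-ext λ i →
  trans (coeff-⊕ p q i)
    (trans (cong₂ _xor_ (coeff-cong p≃p' i) (coeff-cong q≃q' i)) (sym (coeff-⊕ p' q' i)))

⊕-congˡ : ∀ p {q q'} → q ≃ q' → p ⊕ q ≃ p ⊕ q'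
⊕-congˡ p = ⊕-cong ≃-refl

⊕-congʳ : ∀ q {p p'} → p ≃ p' → p ⊕ q ≃ p' ⊕ q
⊕-congʳ q p≃p' = ⊕-cong p≃p' ≃-refl

⊕-comm : ∀ p q → p ⊕ q ≃ q ⊕ p
⊕-comm p q = coeff-ext λ i →
  trans (coeff-⊕ p q i) (trans (xor-comm (coeff p i) (coeff q i)) (sym (coeff-⊕ q p i)))

⊕-assoc : ∀ p q r → (p ⊕ q) ⊕ r ≃ p ⊕ (q ⊕ r)
⊕-assoc p q r = coeff-ext λ i →
  trans (coeff-⊕ (p ⊕ q) r i)
    (trans (cong (_xor coeff r i) (coeff-⊕ p q i))
      (trans (xor-assoc (coeff p i) (coeff q i) (coeff r i))
        (sym (trans (coeff-⊕ p (q ⊕ r) i) (cong (coeff p i xor_) (coeff-⊕ q r i))))))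

⊕-identityʳ : ∀ p → p ⊕ [] ≃ p
⊕-identityʳ p = ⊕-comm p []

⊕-self : ∀ p → p ⊕ p ≃ []
⊕-self p = coeff-ext λ i → trans (coeff-⊕ p p i) (xor-same (coeff p i))

⊕-commutativeSemigroup : CommutativeSemigroup 0ℓ 0ℓ
⊕-commutativeSemigroup = record
  { _∙_ = _⊕_
  ; isCommutativeSemigroup = record
    { isSemigroup = record
      { isMagma = record { isEquivalence = Setoid.isEquivalence ≃-setoid ; ∙-cong = ⊕-cong }
      ; assoc = ⊕-assoc }
    ; comm = ⊕-comm } }

open CommSemigroupProperties ⊕-commutativeSemigroup public
  using (interchange; x∙yz≈y∙xz; x∙yz≈yx∙z)

⊕≃[]⇒≃ : ∀ p q → p ⊕ q ≃ [] → p ≃ q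
⊕≃[]⇒≃ p q p⊕q≃[] = begin
  p              ≈⟨ ⊕-identityʳ p ⟨
  p ⊕ []         ≈⟨ ⊕-cong ≃-refl (⊕-self q) ⟨
  p ⊕ (q ⊕ q)    ≈⟨ ⊕-assoc p q q ⟨
  (p ⊕ q) ⊕ q    ≈⟨ ⊕-cong p⊕q≃[] ≃-refl ⟩
  q              ∎
  where open ≃-Reasoning

scale : Bool → Poly → Poly
scale a q = if a then q else []

⊗-∷ : ∀ a p q → (a ∷ p) ⊗ q ≡ scale a q ⊕ (false ∷ p ⊗ q)
⊗-∷ true  p q = refl
⊗-∷ false p q = refl

scale-cong : ∀ a {q q'} → q ≃ q' → scale a q ≃ scale a q'
scale-cong true  q≃q' = q≃q'
scale-cong false q≃q' = ≃-refl

scale-xor : ∀ a b q → scale (a xor b) q ≃ scale a q ⊕ scale b q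
scale-xor true  true  q = ≃-sym (⊕-self q)
scale-xor true  false q = ≃-sym (⊕-identityʳ q)
scale-xor false b     q = ≃-refl

scale-⊕ : ∀ a p q → scale a (p ⊕ q) ≡ scale a p ⊕ scale a q
scale-⊕ true  p q = refl
scale-⊕ false p q = refl

scale-swap : ∀ a b p q →
  scale a (b ∷ p) ⊕ (false ∷ scale b q) ≃ scale b (a ∷ q) ⊕ (false ∷ scale a p)
scale-swap true  true  p q = ∷-cong true (⊕-comm p q)
scale-swap true  false p q = ∷-cong false (⊕-identityʳ p)
scale-swap false true  p q = ∷-cong false (≃-sym (⊕-identityʳ q))
scale-swap false false p q = ≃-refl

scale-⊗ : ∀ a q s → scale a q ⊗ s ≡ scale a (q ⊗ s)
scale-⊗ true  q s = refl
scale-⊗ false q s = refl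

⊗-congˡ : ∀ p {q q'} → q ≃ q' → p ⊗ q ≃ p ⊗ q'
⊗-congˡ []      q≃q' = ≃-refl
⊗-congˡ (a ∷ p) {q} {q'} q≃q' = begin
  (a ∷ p) ⊗ q                   ≡⟨ ⊗-∷ a p q ⟩
  scale a q ⊕ (false ∷ p ⊗ q)   ≈⟨ ⊕-cong (scale-cong a q≃q') (∷-cong false (⊗-congˡ p q≃q')) ⟩
  scale a q' ⊕ (false ∷ p ⊗ q') ≡⟨ ⊗-∷ a p q' ⟨
  (a ∷ p) ⊗ q'                  ∎
  where open ≃-Reasoning

⊗-distribʳ : ∀ p p' q → (p ⊕ p') ⊗ q ≃ p ⊗ q ⊕ p' ⊗ q
⊗-distribʳ []      p'       q = ≃-refl
⊗-distribʳ (a ∷ p) []       q = ≃-sym (⊕-identityʳ ((a ∷ p) ⊗ q))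
⊗-distribʳ (a ∷ p) (b ∷ p') q = begin
  ((a xor b) ∷ (p ⊕ p')) ⊗ q
    ≡⟨ ⊗-∷ (a xor b) (p ⊕ p') q ⟩
  scale (a xor b) q ⊕ (false ∷ (p ⊕ p') ⊗ q)
    ≈⟨ ⊕-cong (scale-xor a b q) (∷-cong false (⊗-distribʳ p p' q)) ⟩
  (scale a q ⊕ scale b q) ⊕ ((false ∷ p ⊗ q) ⊕ (false ∷ p' ⊗ q))
    ≈⟨ interchange (scale a q) (scale b q) (false ∷ p ⊗ q) (false ∷ p' ⊗ q) ⟩
  (scale a q ⊕ (false ∷ p ⊗ q)) ⊕ (scale b q ⊕ (false ∷ p' ⊗ q))
    ≡⟨ cong₂ _⊕_ (⊗-∷ a p q) (⊗-∷ b p' q) ⟨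
  (a ∷ p) ⊗ q ⊕ (b ∷ p') ⊗ q
    ∎
  where open ≃-Reasoning

⊗-distribˡ : ∀ p q q' → p ⊗ (q ⊕ q') ≃ p ⊗ q ⊕ p ⊗ q'
⊗-distribˡ []      q q' = ≃-refl
⊗-distribˡ (a ∷ p) q q' = begin
  (a ∷ p) ⊗ (q ⊕ q')
    ≡⟨ ⊗-∷ a p (q ⊕ q') ⟩
  scale a (q ⊕ q') ⊕ (false ∷ p ⊗ (q ⊕ q'))
    ≈⟨ ⊕-cong (≃-reflexive (scale-⊕ a q q')) (∷-cong false (⊗-distribˡ p q q')) ⟩
  (scale a q ⊕ scale a q') ⊕ ((false ∷ p ⊗ q) ⊕ (false ∷ p ⊗ q'))
    ≈⟨ interchange (scale a q) (scale a q') (false ∷ p ⊗ q) (false ∷ p ⊗ q') ⟩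
  (scale a q ⊕ (false ∷ p ⊗ q)) ⊕ (scale a q' ⊕ (false ∷ p ⊗ q'))
    ≡⟨ cong₂ _⊕_ (⊗-∷ a p q) (⊗-∷ a p q') ⟨
  (a ∷ p) ⊗ q ⊕ (a ∷ p) ⊗ q'
    ∎
  where open ≃-Reasoning

⊗-zeroʳ : ∀ p → p ⊗ [] ≃ []
⊗-zeroʳ []          = ≃-refl
⊗-zeroʳ (true ∷ p)  = ≃-trans (∷-cong false (⊗-zeroʳ p)) (mk≃ refl)
⊗-zeroʳ (false ∷ p) = ≃-trans (∷-cong false (⊗-zeroʳ p)) (mk≃ refl)

⊗-∷ʳ : ∀ q b p → q ⊗ (b ∷ p) ≃ scale b q ⊕ (false ∷ q ⊗ p)
⊗-∷ʳ []      true  p = mk≃ refl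
⊗-∷ʳ []      false p = mk≃ refl
⊗-∷ʳ (a ∷ q) b     p = begin
  (a ∷ q) ⊗ (b ∷ p)
    ≡⟨ ⊗-∷ a q (b ∷ p) ⟩
  scale a (b ∷ p) ⊕ (false ∷ q ⊗ (b ∷ p))
    ≈⟨ ⊕-cong ≃-refl (∷-cong false (⊗-∷ʳ q b p)) ⟩
  scale a (b ∷ p) ⊕ ((false ∷ scale b q) ⊕ (false ∷ false ∷ q ⊗ p))
    ≈⟨ ⊕-assoc (scale a (b ∷ p)) (false ∷ scale b q) (false ∷ false ∷ q ⊗ p) ⟨
  (scale a (b ∷ p) ⊕ (false ∷ scale b q)) ⊕ (false ∷ false ∷ q ⊗ p)
    ≈⟨ ⊕-cong (scale-swap a b p q) ≃-refl ⟩
  (scale b (a ∷ q) ⊕ (false ∷ scale a p)) ⊕ (false ∷ false ∷ q ⊗ p)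
    ≈⟨ ⊕-assoc (scale b (a ∷ q)) (false ∷ scale a p) (false ∷ false ∷ q ⊗ p) ⟩
  scale b (a ∷ q) ⊕ (false ∷ (scale a p ⊕ (false ∷ q ⊗ p)))
    ≡⟨ cong (λ r → scale b (a ∷ q) ⊕ (false ∷ r)) (⊗-∷ a q p) ⟨
  scale b (a ∷ q) ⊕ (false ∷ (a ∷ q) ⊗ p)
    ∎
  where open ≃-Reasoning

⊗-comm : ∀ p q → p ⊗ q ≃ q ⊗ p
⊗-comm []      q = ≃-sym (⊗-zeroʳ q)
⊗-comm (a ∷ p) q = begin
  (a ∷ p) ⊗ q                 ≡⟨ ⊗-∷ a p q ⟩
  scale a q ⊕ (false ∷ p ⊗ q) ≈⟨ ⊕-cong ≃-refl (∷-cong false (⊗-comm p q)) ⟩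
  scale a q ⊕ (false ∷ q ⊗ p) ≈⟨ ⊗-∷ʳ q a p ⟨
  q ⊗ (a ∷ p)                 ∎
  where open ≃-Reasoning

⊗-cong : ∀ {p p' q q'} → p ≃ p' → q ≃ q' → p ⊗ q ≃ p' ⊗ q'
⊗-cong {p} {p'} {q} {q'} p≃p' q≃q' = begin
  p ⊗ q   ≈⟨ ⊗-congˡ p q≃q' ⟩
  p ⊗ q'  ≈⟨ ⊗-comm p q' ⟩
  q' ⊗ p  ≈⟨ ⊗-congˡ q' p≃p' ⟩
  q' ⊗ p' ≈⟨ ⊗-comm q' p' ⟩
  p' ⊗ q' ∎
  where open ≃-Reasoning

⊗-congʳ : ∀ q {p p'} → p ≃ p' → p ⊗ q ≃ p' ⊗ q
⊗-congʳ q p≃p' = ⊗-cong p≃p' ≃-refl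

⊗-assoc : ∀ p q s → (p ⊗ q) ⊗ s ≃ p ⊗ (q ⊗ s)
⊗-assoc []      q s = ≃-refl
⊗-assoc (a ∷ p) q s = begin
  ((a ∷ p) ⊗ q) ⊗ s                     ≡⟨ cong (_⊗ s) (⊗-∷ a p q) ⟩
  (scale a q ⊕ (false ∷ p ⊗ q)) ⊗ s     ≈⟨ ⊗-distribʳ (scale a q) (false ∷ p ⊗ q) s ⟩
  scale a q ⊗ s ⊕ (false ∷ (p ⊗ q) ⊗ s) ≈⟨ ⊕-cong (≃-reflexive (scale-⊗ a q s))
                                                   (∷-cong false (⊗-assoc p q s)) ⟩
  scale a (q ⊗ s) ⊕ (false ∷ p ⊗ (q ⊗ s)) ≡⟨ ⊗-∷ a p (q ⊗ s) ⟨
  (a ∷ p) ⊗ (q ⊗ s)                     ∎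
  where open ≃-Reasoning

⊗-identityˡ : ∀ q → one ⊗ q ≃ q
⊗-identityˡ q = ≃-trans (⊕-cong {q} ≃-refl (mk≃ refl)) (⊕-identityʳ q)

⊗-identityʳ : ∀ q → q ⊗ one ≃ q
⊗-identityʳ q = ≃-trans (⊗-comm q one) (⊗-identityˡ q)

⊗-commutativeSemigroup : CommutativeSemigroup 0ℓ 0ℓ
⊗-commutativeSemigroup = record
  { _∙_ = _⊗_
  ; isCommutativeSemigroup = record
    { isSemigroup = record
      { isMagma = record { isEquivalence = Setoid.isEquivalence ≃-setoid ; ∙-cong = ⊗-cong }
      ; assoc = ⊗-assoc }
    ; comm = ⊗-comm } }

open CommSemigroupProperties ⊗-commutativeSemigroup public
  using () renaming (x∙yz≈y∙xz to x⊗yz≃y⊗xz)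

size-cong : ∀ {p q} → p ≃ q → size p ≡ size q
size-cong (mk≃ p≈q) = cong length p≈q

size≡0⇒≃[] : ∀ p → size p ≡ 0 → p ≃ []
size≡0⇒≃[] p eq = mk≃ (empty (norm p) eq)
  where
  empty : ∀ xs → length xs ≡ 0 → xs ≡ []
  empty [] _ = refl

coeff-≥size : ∀ p i → size p ≤ i → coeff p i ≡ false
coeff-≥size p i le = trans (sym (coeff-norm p i)) (beyond (norm p) i le)
  where
  beyond : ∀ xs i → length xs ≤ i → coeff xs i ≡ false
  beyond []       i       _        = refl
  beyond (x ∷ xs) (suc i) (s≤s le) = beyond xs i le

size-∷-≤ : ∀ b p → size (b ∷ p) ≤ suc (size p)
size-∷-≤ b p = subst (_≤ suc (size p)) (sym (cong length (norm-∷ b p))) (bound b (norm p))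
  where
  bound : ∀ b xs → length (normCons b xs) ≤ suc (length xs)
  bound true  []      = ≤-refl
  bound false []      = z≤n
  bound b     (c ∷ r) = ≤-refl

size-∷ : ∀ b p {n} → size p ≡ suc n → size (b ∷ p) ≡ suc (suc n)
size-∷ b p eq = trans (cong length (norm-∷ b p)) (grow b (norm p) eq)
  where
  grow : ∀ b xs {n} → length xs ≡ suc n → length (normCons b xs) ≡ suc (suc n)
  grow b (c ∷ r) eq = cong suc eq

size≤ : ∀ p n → (∀ i → n ≤ i → coeff p i ≡ false) → size p ≤ n
size≤ []      n       high = z≤n
size≤ (b ∷ p) zero    high = ≤-reflexive (size-cong (coeff-ext {b ∷ p} {[]} λ i → high i z≤n))
size≤ (b ∷ p) (suc n) high =
  ≤-trans (size-∷-≤ b p) (s≤s (size≤ p n λ i n≤i → high (suc i) (s≤s n≤i)))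

coeff-leading : ∀ p d → size p ≡ suc d → coeff p d ≡ true
coeff-leading p d eq with coeff p d in cd
... | true  = refl
... | false = ⊥-elim (<⇒≱ (≤-reflexive (sym eq)) (size≤ p d high))
  where
  high : ∀ i → d ≤ i → coeff p i ≡ false
  high i d≤i with d ≟ i
  ... | yes refl = cd
  ... | no d≢i   = coeff-≥size p i (subst (_≤ i) (sym eq) (≤∧≢⇒< d≤i d≢i))

true≢false : true ≢ false
true≢false ()

size-exact : ∀ p d → coeff p d ≡ true → (∀ i → suc d ≤ i → coeff p i ≡ false) → size p ≡ suc d
size-exact p d lead high = ≤-antisym (size≤ p (suc d) high)
  (≰⇒> λ size≤d → true≢false (trans (sym lead) (coeff-≥size p d size≤d)))

size-⊕-< : ∀ u v → size u < size v → size (u ⊕ v) ≡ size v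
size-⊕-< u v u<v with size v in eq
... | suc d = size-exact (u ⊕ v) d
  (trans (coeff-⊕ u v d) (cong₂ _xor_ (coeff-≥size u d (≤-pred u<v)) (coeff-leading v d eq)))
  λ i d<i → trans (coeff-⊕ u v i)
    (cong₂ _xor_ (coeff-≥size u i (≤-trans (n≤1+n _) (≤-trans u<v d<i)))
                 (coeff-≥size v i (subst (_≤ i) (sym eq) d<i)))

size-scale : ∀ a q → size (scale a q) ≤ size q
size-scale true  q = ≤-refl
size-scale false q = z≤n

size-⊗ : ∀ p q {m n} → size p ≡ suc m → size q ≡ suc n → size (p ⊗ q) ≡ suc (m + n)
size-⊗ (a ∷ p) q {m} {n} sp sq with size p in eq
... | zero with a
...   | true  = begin
  size (q ⊕ (false ∷ p ⊗ q)) ≡⟨ size-cong (⊕-congˡ q (≃-trans (∷-cong false p⊗q≃[]) (mk≃ refl))) ⟩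
  size (q ⊕ [])              ≡⟨ size-cong (⊕-identityʳ q) ⟩
  size q                     ≡⟨ sq ⟩
  suc n                      ≡⟨ cong (λ k → suc (k + n)) m≡0 ⟨
  suc (m + n)                ∎
  where
  open ≡-Reasoning
  p⊗q≃[] : p ⊗ q ≃ []
  p⊗q≃[] = ⊗-congʳ q (size≡0⇒≃[] p eq)
  m≡0 : m ≡ 0
  m≡0 = suc-injective (trans (sym sp) (size-cong (∷-cong true (size≡0⇒≃[] p eq))))
...   | false = case trans (sym sp) (size-cong (∷-cong false (size≡0⇒≃[] p eq))) of λ ()
size-⊗ (a ∷ p) q {m} {n} sp sq | suc k = begin
  size ((a ∷ p) ⊗ q)                  ≡⟨ cong size (⊗-∷ a p q) ⟩
  size (scale a q ⊕ (false ∷ p ⊗ q))  ≡⟨ size-⊕-< (scale a q) (false ∷ p ⊗ q) scale<shift ⟩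
  size (false ∷ p ⊗ q)                ≡⟨ shift ⟩
  suc (suc (k + n))                   ≡⟨ cong (λ j → suc (j + n)) m≡1+k ⟨
  suc (m + n)                         ∎
  where
  open ≡-Reasoning
  shift : size (false ∷ p ⊗ q) ≡ suc (suc (k + n))
  shift = size-∷ false (p ⊗ q) (size-⊗ p q eq sq)
  m≡1+k : m ≡ suc k
  m≡1+k = suc-injective (trans (sym sp) (size-∷ a p eq))
  scale<shift : size (scale a q) < size (false ∷ p ⊗ q)
  scale<shift = subst (size (scale a q) <_) (sym shift)
    (s≤s (≤-trans (size-scale a q) (subst (_≤ suc (k + n)) (sym sq) (s≤s (m≤n+m n k)))))

⊗-cancelˡ : ∀ t {u w k} → size t ≡ suc k → t ⊗ u ≃ t ⊗ w → u ≃ w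
⊗-cancelˡ t {u} {w} st tu≃tw with size (u ⊕ w) in eq
... | zero  = ⊕≃[]⇒≃ u w (size≡0⇒≃[] (u ⊕ w) eq)
... | suc j = case trans (sym (size-⊗ t (u ⊕ w) st eq)) (size-cong t[u⊕w]≃[]) of λ ()
  where
  t[u⊕w]≃[] : t ⊗ (u ⊕ w) ≃ []
  t[u⊕w]≃[] = ≃-trans (⊗-distribˡ t u w) (≃-trans (⊕-cong tu≃tw ≃-refl) (⊕-self (t ⊗ w)))

size≡1⇒≃one : ∀ q → size q ≡ 1 → q ≃ one
size≡1⇒≃one q eq = coeff-ext λ where
  zero    → coeff-leading q 0 eq
  (suc i) → coeff-≥size q (suc i) (subst (_≤ suc i) (sym eq) (s≤s z≤n))

size-factors : ∀ p q {k} → size (p ⊗ q) ≡ suc k →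
  Σ[ m ∈ ℕ ] Σ[ n ∈ ℕ ] size p ≡ suc m × size q ≡ suc n × k ≡ m + n
size-factors p q {k} spq with size p in ep | size q in eq
... | zero  | _     = case trans (sym spq) (size-cong (⊗-congʳ q (size≡0⇒≃[] p ep))) of λ ()
... | suc m | zero  =
  case trans (sym spq) (size-cong (≃-trans (⊗-congˡ p (size≡0⇒≃[] q eq)) (⊗-zeroʳ p))) of λ ()
... | suc m | suc n = m , n , refl , refl , suc-injective (trans (sym spq) (size-⊗ p q ep eq))

⊗≃one⇒≃one : ∀ p q → p ⊗ q ≃ one → q ≃ one
⊗≃one⇒≃one p q pq≃one with size-factors p q (size-cong pq≃one)
... | m , n , _ , sq , 0≡m+n = size≡1⇒≃one q (trans sq (cong suc (m+n≡0⇒n≡0 m (sym 0≡m+n))))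

-- Evaluation and division by x + ρ

open CommSemigroupProperties (CommutativeRing.+-commutativeSemigroup xor-∧-commutativeRing)
  using () renaming (interchange to xor-interchange)

eval : Bool → Poly → Bool
eval ρ []      = false
eval ρ (b ∷ p) = b xor (ρ ∧ eval ρ p)

eval-cong : ∀ ρ {p q} → p ≃ q → eval ρ p ≡ eval ρ q
eval-cong ρ {p} {q} (mk≃ p≈q) = trans (sym (eval-norm p)) (trans (cong (eval ρ) p≈q) (eval-norm q))
  where
  eval-normCons : ∀ b r → eval ρ (normCons b r) ≡ eval ρ (b ∷ r)
  eval-normCons true  []      = refl
  eval-normCons false []      = sym (∧-zeroʳ ρ)
  eval-normCons b     (c ∷ r) = refl
  eval-norm : ∀ p → eval ρ (norm p) ≡ eval ρ p
  eval-norm []      = refl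
  eval-norm (b ∷ p) = trans (cong (eval ρ) (norm-∷ b p))
    (trans (eval-normCons b (norm p)) (cong (λ e → b xor (ρ ∧ e)) (eval-norm p)))

eval-⊕ : ∀ ρ p q → eval ρ (p ⊕ q) ≡ eval ρ p xor eval ρ q
eval-⊕ ρ []      q       = refl
eval-⊕ ρ (a ∷ p) []      = sym (xor-identityʳ _)
eval-⊕ ρ (a ∷ p) (b ∷ q) = begin
  (a xor b) xor (ρ ∧ eval ρ (p ⊕ q))
    ≡⟨ cong (λ e → (a xor b) xor (ρ ∧ e)) (eval-⊕ ρ p q) ⟩
  (a xor b) xor (ρ ∧ (eval ρ p xor eval ρ q))
    ≡⟨ cong ((a xor b) xor_) (∧-distribˡ-xor ρ (eval ρ p) (eval ρ q)) ⟩
  (a xor b) xor ((ρ ∧ eval ρ p) xor (ρ ∧ eval ρ q))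
    ≡⟨ xor-interchange a b (ρ ∧ eval ρ p) (ρ ∧ eval ρ q) ⟩
  (a xor (ρ ∧ eval ρ p)) xor (b xor (ρ ∧ eval ρ q))
    ∎
  where open ≡-Reasoning

eval-scale : ∀ ρ a q → eval ρ (scale a q) ≡ a ∧ eval ρ q
eval-scale ρ true  q = refl
eval-scale ρ false q = refl

eval-⊗ : ∀ ρ p q → eval ρ (p ⊗ q) ≡ eval ρ p ∧ eval ρ q
eval-⊗ ρ []      q = refl
eval-⊗ ρ (a ∷ p) q = begin
  eval ρ ((a ∷ p) ⊗ q)
    ≡⟨ cong (eval ρ) (⊗-∷ a p q) ⟩
  eval ρ (scale a q ⊕ (false ∷ p ⊗ q))
    ≡⟨ eval-⊕ ρ (scale a q) (false ∷ p ⊗ q) ⟩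
  eval ρ (scale a q) xor (ρ ∧ eval ρ (p ⊗ q))
    ≡⟨ cong₂ (λ s e → s xor (ρ ∧ e)) (eval-scale ρ a q) (eval-⊗ ρ p q) ⟩
  (a ∧ eval ρ q) xor (ρ ∧ (eval ρ p ∧ eval ρ q))
    ≡⟨ cong ((a ∧ eval ρ q) xor_) (∧-assoc ρ (eval ρ p) (eval ρ q)) ⟨
  (a ∧ eval ρ q) xor ((ρ ∧ eval ρ p) ∧ eval ρ q)
    ≡⟨ ∧-distribʳ-xor (eval ρ q) a (ρ ∧ eval ρ p) ⟨
  (a xor (ρ ∧ eval ρ p)) ∧ eval ρ q
    ∎
  where open ≡-Reasoning

-- x+ false and x+ true are X and X+1.
x+ : Bool → Poly
x+ ρ = ρ ∷ true ∷ []

eval-x+ : ∀ ρ → eval ρ (x+ ρ) ≡ false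
eval-x+ true  = refl
eval-x+ false = refl

quotient : Bool → Poly → Poly
quotient ρ []      = []
quotient ρ (b ∷ p) = eval ρ p ∷ quotient ρ p

x+-division : ∀ ρ p → p ≃ x+ ρ ⊗ quotient ρ p ⊕ (eval ρ p ∷ [])
x+-division ρ []      = ≃-sym (⊕-cong (⊗-zeroʳ (x+ ρ)) (mk≃ refl))
x+-division ρ (b ∷ p) = begin
  b ∷ p
    ≈⟨ ∷-cong b (x+-division ρ p) ⟩
  b ∷ (t ⊗ Q ⊕ (e ∷ []))
    ≡⟨ ∷-split b (t ⊗ Q ⊕ (e ∷ [])) ⟩
  (b ∷ []) ⊕ ((false ∷ t ⊗ Q) ⊕ (false ∷ e ∷ []))
    ≈⟨ x∙yz≈y∙xz (b ∷ []) (false ∷ t ⊗ Q) (false ∷ e ∷ []) ⟩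
  (false ∷ t ⊗ Q) ⊕ ((b ∷ []) ⊕ (false ∷ e ∷ []))
    ≈⟨ ⊕-congˡ (false ∷ t ⊗ Q) (remainder ρ b e) ⟩
  (false ∷ t ⊗ Q) ⊕ (scale e t ⊕ (eval ρ (b ∷ p) ∷ []))
    ≈⟨ x∙yz≈yx∙z (false ∷ t ⊗ Q) (scale e t) (eval ρ (b ∷ p) ∷ []) ⟩
  (scale e t ⊕ (false ∷ t ⊗ Q)) ⊕ (eval ρ (b ∷ p) ∷ [])
    ≈⟨ ⊕-congʳ (eval ρ (b ∷ p) ∷ []) (⊗-∷ʳ t e Q) ⟨
  t ⊗ (e ∷ Q) ⊕ (eval ρ (b ∷ p) ∷ [])
    ∎
  where
  open ≃-Reasoning
  t = x+ ρ
  Q = quotient ρ p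
  e = eval ρ p
  ∷-split : ∀ b w → b ∷ w ≡ (b ∷ []) ⊕ (false ∷ w)
  ∷-split true  w = refl
  ∷-split false w = refl
  remainder : ∀ ρ b e → (b ∷ []) ⊕ (false ∷ e ∷ []) ≃ scale e (x+ ρ) ⊕ ((b xor (ρ ∧ e)) ∷ [])
  remainder true  true  true  = mk≃ refl
  remainder true  true  false = mk≃ refl
  remainder true  false true  = mk≃ refl
  remainder true  false false = mk≃ refl
  remainder false true  true  = mk≃ refl
  remainder false true  false = mk≃ refl
  remainder false false true  = mk≃ refl
  remainder false false false = mk≃ refl

factor-theorem : ∀ ρ p → eval ρ p ≡ false → p ≃ x+ ρ ⊗ quotient ρ p
factor-theorem ρ p root = begin
  p                                             ≈⟨ x+-division ρ p ⟩
  x+ ρ ⊗ quotient ρ p ⊕ (eval ρ p ∷ [])        ≡⟨ cong (λ r → x+ ρ ⊗ quotient ρ p ⊕ (r ∷ [])) root ⟩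
  x+ ρ ⊗ quotient ρ p ⊕ (false ∷ [])           ≈⟨ ⊕-congˡ (x+ ρ ⊗ quotient ρ p) (mk≃ refl) ⟩
  x+ ρ ⊗ quotient ρ p ⊕ []                     ≈⟨ ⊕-identityʳ _ ⟩
  x+ ρ ⊗ quotient ρ p                           ∎
  where open ≃-Reasoning

eval-x+^suc : ∀ ρ m → eval ρ (x+ ρ ^^ suc m) ≡ false
eval-x+^suc ρ m = trans (eval-⊗ ρ (x+ ρ) (x+ ρ ^^ m)) (cong (_∧ eval ρ (x+ ρ ^^ m)) (eval-x+ ρ))

peel-x+ : ∀ ρ m a b → eval ρ b ≡ false → a ⊗ b ≃ x+ ρ ^^ suc m → a ⊗ quotient ρ b ≃ x+ ρ ^^ m
peel-x+ ρ m a b root ab≃t^[1+m] = ⊗-cancelˡ (x+ ρ) refl (begin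
  x+ ρ ⊗ (a ⊗ quotient ρ b) ≈⟨ x⊗yz≃y⊗xz (x+ ρ) a (quotient ρ b) ⟩
  a ⊗ (x+ ρ ⊗ quotient ρ b) ≈⟨ ⊗-congˡ a (factor-theorem ρ b root) ⟨
  a ⊗ b                     ≈⟨ ab≃t^[1+m] ⟩
  x+ ρ ^^ suc m             ∎)
  where open ≃-Reasoning

nonroot⇒cofactor-root : ∀ ρ m a b → eval ρ b ≡ true → a ⊗ b ≃ x+ ρ ^^ suc m → eval ρ a ≡ false
nonroot⇒cofactor-root ρ m a b nonroot ab≃t^[1+m] = begin
  eval ρ a               ≡⟨ ∧-identityʳ (eval ρ a) ⟨
  eval ρ a ∧ true        ≡⟨ cong (eval ρ a ∧_) nonroot ⟨
  eval ρ a ∧ eval ρ b    ≡⟨ eval-⊗ ρ a b ⟨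
  eval ρ (a ⊗ b)         ≡⟨ eval-cong ρ ab≃t^[1+m] ⟩
  eval ρ (x+ ρ ^^ suc m) ≡⟨ eval-x+^suc ρ m ⟩
  false                  ∎
  where open ≡-Reasoning

-- Whichever of q and c vanishes at ρ gives up a factor x + ρ.
divisor-of-x+^ : ∀ ρ m q c → q ⊗ c ≃ x+ ρ ^^ m → Σ[ k ∈ ℕ ] k ≤ m × c ≃ x+ ρ ^^ k
divisor-of-x+^ ρ zero    q c qc≃1 = 0 , z≤n , ⊗≃one⇒≃one q c qc≃1
divisor-of-x+^ ρ (suc m) q c qc≃t^[1+m] with eval ρ c in root-c
... | false with divisor-of-x+^ ρ m q (quotient ρ c) (peel-x+ ρ m q c root-c qc≃t^[1+m])
...   | k , k≤m , c'≃t^k =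
  suc k , s≤s k≤m , ≃-trans (factor-theorem ρ c root-c) (⊗-congˡ (x+ ρ) c'≃t^k)
divisor-of-x+^ ρ (suc m) q c qc≃t^[1+m] | true
  with divisor-of-x+^ ρ m (quotient ρ q) c
         (≃-trans (⊗-comm (quotient ρ q) c)
           (peel-x+ ρ m c q (nonroot⇒cofactor-root ρ m q c root-c qc≃t^[1+m])
             (≃-trans (⊗-comm c q) qc≃t^[1+m])))
... | k , k≤m , c≃t^k = k , m≤n⇒m≤1+n k≤m , c≃t^k

-- σ of a power of x + ρ

_≟ₚ_ : DecidableEquality Poly
_≟ₚ_ = ≡-dec Bool._≟_

open import Data.List.Membership.DecPropositional _≟ₚ_ using (_∈?_)

selectSum : (Poly → Bool) → List Poly → Poly
selectSum f []      = []
selectSum f (c ∷ L) = if f c then c ⊕ selectSum f L else selectSum f L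

foldr-filter : ∀ {P : Poly → Set} (P? : Decidable P) L →
               foldr _⊕_ [] (filter P? L) ≡ selectSum (does ∘ P?) L
foldr-filter P? []      = refl
foldr-filter P? (c ∷ L) with does (P? c)
... | true  = cong (c ⊕_) (foldr-filter P? L)
... | false = foldr-filter P? L

selectSum-cong : ∀ {f g} L → (∀ {c} → c ∈ L → f c ≡ g c) → selectSum f L ≡ selectSum g L
selectSum-cong []      f≗g = refl
selectSum-cong (c ∷ L) f≗g rewrite f≗g (here refl) | selectSum-cong L (f≗g ∘ there) = refl

selectSum-xor : ∀ f g L → selectSum (λ c → f c xor g c) L ≃ selectSum f L ⊕ selectSum g L
selectSum-xor f g []      = ≃-refl
selectSum-xor f g (c ∷ L) with f c | g c
... | true  | true  = begin
  selectSum (λ c → f c xor g c) L          ≈⟨ selectSum-xor f g L ⟩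
  Sf ⊕ Sg                                   ≈⟨ ⊕-congʳ (Sf ⊕ Sg) (⊕-self c) ⟨
  (c ⊕ c) ⊕ (Sf ⊕ Sg)                       ≈⟨ interchange c c Sf Sg ⟩
  (c ⊕ Sf) ⊕ (c ⊕ Sg)                       ∎
  where
  open ≃-Reasoning
  Sf = selectSum f L
  Sg = selectSum g L
... | true  | false =
  ≃-trans (⊕-congˡ c (selectSum-xor f g L)) (≃-sym (⊕-assoc c (selectSum f L) (selectSum g L)))
... | false | true  =
  ≃-trans (⊕-congˡ c (selectSum-xor f g L)) (x∙yz≈y∙xz c (selectSum f L) (selectSum g L))
... | false | false = selectSum-xor f g L

selectSum-false : ∀ L → selectSum (λ _ → false) L ≡ []
selectSum-false []      = refl
selectSum-false (c ∷ L) = selectSum-false L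

selectSum-≟ : ∀ v L → v ∈ L → Unique L → selectSum (λ c → does (c ≟ₚ v)) L ≃ v
selectSum-≟ v (c ∷ L) (here refl) (c∉L ∷ _) with v ≟ₚ v
... | no v≢v = ⊥-elim (v≢v refl)
... | yes _  = ≃-trans (⊕-congˡ v (≃-reflexive (trans (selectSum-cong L skip) (selectSum-false L))))
                       (⊕-identityʳ v)
  where
  skip : ∀ {d} → d ∈ L → does (d ≟ₚ v) ≡ false
  skip d∈L = dec-false (_ ≟ₚ v) λ d≡v → All.lookup c∉L d∈L (sym d≡v)
selectSum-≟ v (c ∷ L) (there v∈L) (c∉L ∷ uL) with c ≟ₚ v
... | yes refl = ⊥-elim (All.lookup c∉L v∈L refl)
... | no _     = selectSum-≟ v L v∈L uL

selectSum-∈ : ∀ V L → Unique V → Unique L → (∀ {v} → v ∈ V → v ∈ L) →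
              selectSum (λ c → does (c ∈? V)) L ≃ foldr _⊕_ [] V
selectSum-∈ []      L _            _  _    = ≃-reflexive (selectSum-false L)
selectSum-∈ (v ∷ V) L (v∉V ∷ uV) uL V⊆L = begin
  selectSum (λ c → does (c ∈? v ∷ V)) L
    ≡⟨ selectSum-cong L (λ {c} _ → disjoint c) ⟩
  selectSum (λ c → does (c ≟ₚ v) xor does (c ∈? V)) L
    ≈⟨ selectSum-xor (λ c → does (c ≟ₚ v)) (λ c → does (c ∈? V)) L ⟩
  selectSum (λ c → does (c ≟ₚ v)) L ⊕ selectSum (λ c → does (c ∈? V)) L
    ≈⟨ ⊕-cong (selectSum-≟ v L (V⊆L (here refl)) uL) (selectSum-∈ V L uV uL (V⊆L ∘ there)) ⟩
  v ⊕ foldr _⊕_ [] V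
    ∎
  where
  open ≃-Reasoning
  disjoint : ∀ c → does (c ≟ₚ v) ∨ does (c ∈? V) ≡ does (c ≟ₚ v) xor does (c ∈? V)
  disjoint c with c ≟ₚ v
  ... | yes refl rewrite dec-false (c ∈? V) (All¬⇒¬Any v∉V) = refl
  ... | no _     = refl

∈-polysOfLength⁻ : ∀ n {c} → c ∈ polysOfLength n → length c ≡ n
∈-polysOfLength⁻ zero    (here refl) = refl
∈-polysOfLength⁻ (suc n) c∈ with find (∈-concatMap⁻ _ {xs = polysOfLength n} c∈)
... | p , p∈ , here refl         = cong suc (∈-polysOfLength⁻ n p∈)
... | p , p∈ , there (here refl) = cong suc (∈-polysOfLength⁻ n p∈)

∈-polysOfLength⁺ : ∀ n c → length c ≡ n → c ∈ polysOfLength n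
∈-polysOfLength⁺ zero    []      refl = here refl
∈-polysOfLength⁺ (suc n) (b ∷ c) eq   =
  ∈-concatMap⁺ _ {xs = polysOfLength n} (lose (∈-polysOfLength⁺ n c (suc-injective eq)) (spread b))
  where
  spread : ∀ b → (b ∷ c) ∈ (false ∷ c) ∷ (true ∷ c) ∷ []
  spread false = here refl
  spread true  = there (here refl)

unique-polysOfLength : ∀ n → Unique (polysOfLength n)
unique-polysOfLength zero    = [] ∷ []
unique-polysOfLength (suc n) = go (polysOfLength n) (unique-polysOfLength n)
  where
  tail∈ : ∀ {c} L → c ∈ concatMap (λ p → (false ∷ p) ∷ (true ∷ p) ∷ []) L →
          Σ[ b ∈ Bool ] Σ[ p ∈ Poly ] p ∈ L × c ≡ b ∷ p
  tail∈ L c∈ with find (∈-concatMap⁻ _ {xs = L} c∈)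
  ... | p , p∈ , here refl         = false , p , p∈ , refl
  ... | p , p∈ , there (here refl) = true , p , p∈ , refl
  go : ∀ L → Unique L → Unique (concatMap (λ p → (false ∷ p) ∷ (true ∷ p) ∷ []) L)
  go []      []         = []
  go (p ∷ L) (p∉L ∷ uL) = ((λ ()) ∷ fresh false) ∷ fresh true ∷ go L uL
    where
    fresh : ∀ b → All ((b ∷ p) ≢_) (concatMap (λ p → (false ∷ p) ∷ (true ∷ p) ∷ []) L)
    fresh b = All.tabulate λ c∈ → case tail∈ L c∈ of λ where
      (b' , p' , p'∈ , refl) eq → All.lookup p∉L p'∈ (∷-injectiveʳ eq)

σ≃sum : ∀ a V → Unique V → (∀ {v} → v ∈ V → v ∈ polysOfLength (size a)) →
  (∀ {c} → c ∈ polysOfLength (size a) → Any (λ q → q ⊗ c ≈ a) (polysOfLength (size a)) ⇔ c ∈ V) →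
  σ a ≃ foldr _⊕_ [] V
σ≃sum a V uV V⊆L divisor⇔∈ = begin
  σ a                                  ≡⟨ foldr-filter (divides? a) L ⟩
  selectSum (does ∘ divides? a) L      ≡⟨ selectSum-cong L (λ c∈L →
                                            does-⇔ (divisor⇔∈ c∈L) (divides? a _) (_ ∈? V)) ⟩
  selectSum (λ c → does (c ∈? V)) L    ≈⟨ selectSum-∈ V L uV (unique-polysOfLength (size a)) V⊆L ⟩
  foldr _⊕_ [] V                       ∎
  where
  open ≃-Reasoning
  L = polysOfLength (size a)

-- σ a runs over polynomials of length size a, so each divisor enters in this padded form.
pad : ℕ → Poly → Poly
pad n p = norm p ++ replicate (n ∸ size p) false

pad-≃ : ∀ n p → pad n p ≃ p
pad-≃ n p = coeff-ext λ i → trans (coeff-++-zeros (norm p) (n ∸ size p) i) (coeff-norm p i)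
  where
  coeff-++-zeros : ∀ xs k i → coeff (xs ++ replicate k false) i ≡ coeff xs i
  coeff-++-zeros []       zero    i       = refl
  coeff-++-zeros []       (suc k) zero    = refl
  coeff-++-zeros []       (suc k) (suc i) = coeff-++-zeros [] k i
  coeff-++-zeros (x ∷ xs) k       zero    = refl
  coeff-++-zeros (x ∷ xs) k       (suc i) = coeff-++-zeros xs k i

length-pad : ∀ n p → size p ≤ n → length (pad n p) ≡ n
length-pad n p le =
  trans (length-++ (norm p))
    (trans (cong (size p +_) (length-replicate (n ∸ size p))) (m+[n∸m]≡n le))

≃∧length⇒≡ : ∀ c d → length c ≡ length d → c ≃ d → c ≡ d
≃∧length⇒≡ []      []      _  _   = refl
≃∧length⇒≡ (a ∷ c) (b ∷ d) eq c≃d =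
  cong₂ _∷_ (coeff-cong c≃d zero)
    (≃∧length⇒≡ c d (suc-injective eq) (coeff-ext λ i → coeff-cong c≃d (suc i)))

^^-+ : ∀ p i j → p ^^ i ⊗ p ^^ j ≃ p ^^ (i + j)
^^-+ p zero    j = ⊗-identityˡ (p ^^ j)
^^-+ p (suc i) j = ≃-trans (⊗-assoc p (p ^^ i) (p ^^ j)) (⊗-congˡ p (^^-+ p i j))

size-x+^ : ∀ ρ k → size (x+ ρ ^^ k) ≡ suc k
size-x+^ ρ zero    = refl
size-x+^ ρ (suc k) = size-⊗ (x+ ρ) (x+ ρ ^^ k) refl (size-x+^ ρ k)

geometric : Poly → ℕ → Poly
geometric p zero    = []
geometric p (suc k) = p ^^ k ⊕ geometric p k

module _ (ρ : Bool) (n : ℕ) where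

  paddedPowers : ℕ → List Poly
  paddedPowers zero    = []
  paddedPowers (suc k) = pad n (x+ ρ ^^ k) ∷ paddedPowers k

  size-paddedPower : ∀ k → size (pad n (x+ ρ ^^ k)) ≡ suc k
  size-paddedPower k = trans (size-cong (pad-≃ n (x+ ρ ^^ k))) (size-x+^ ρ k)

  ∈-paddedPowers⁻ : ∀ j {c} → c ∈ paddedPowers j → Σ[ k ∈ ℕ ] k < j × c ≡ pad n (x+ ρ ^^ k)
  ∈-paddedPowers⁻ (suc j) (here refl) = j , ≤-refl , refl
  ∈-paddedPowers⁻ (suc j) (there c∈) with ∈-paddedPowers⁻ j c∈
  ... | k , k<j , refl = k , m≤n⇒m≤1+n k<j , refl

  ∈-paddedPowers⁺ : ∀ j k → k < j → pad n (x+ ρ ^^ k) ∈ paddedPowers j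
  ∈-paddedPowers⁺ (suc j) k (s≤s k≤j) with k Data.Nat.≟ j
  ... | yes refl = here refl
  ... | no k≢j   = there (∈-paddedPowers⁺ j k (≤∧≢⇒< k≤j k≢j))

  unique-paddedPowers : ∀ j → Unique (paddedPowers j)
  unique-paddedPowers zero    = []
  unique-paddedPowers (suc j) = All.tabulate fresh ∷ unique-paddedPowers j
    where
    fresh : ∀ {c} → c ∈ paddedPowers j → pad n (x+ ρ ^^ j) ≢ c
    fresh c∈ eq with ∈-paddedPowers⁻ j c∈
    ... | k , k<j , refl = <-irrefl (suc-injective (begin
      suc k                        ≡⟨ size-paddedPower k ⟨
      size (pad n (x+ ρ ^^ k))     ≡⟨ cong size eq ⟨
      size (pad n (x+ ρ ^^ j))     ≡⟨ size-paddedPower j ⟩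
      suc j                        ∎)) k<j
      where open ≡-Reasoning

  sum-paddedPowers : ∀ j → foldr _⊕_ [] (paddedPowers j) ≃ geometric (x+ ρ) j
  sum-paddedPowers zero    = ≃-refl
  sum-paddedPowers (suc j) = ⊕-cong (pad-≃ n (x+ ρ ^^ j)) (sum-paddedPowers j)

σ-x+^ : ∀ ρ m → σ (x+ ρ ^^ m) ≃ geometric (x+ ρ) (suc m)
σ-x+^ ρ m = ≃-trans (σ≃sum a V (unique-paddedPowers ρ n (suc m)) V⊆L divisor⇔∈)
                    (sum-paddedPowers ρ n (suc m))
  where
  t = x+ ρ
  a = t ^^ m
  n = size a
  L = polysOfLength n
  V = paddedPowers ρ n (suc m)

  length-paddedPower : ∀ k → k ≤ m → length (pad n (t ^^ k)) ≡ n
  length-paddedPower k k≤m = length-pad n (t ^^ k)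
    (subst₂ _≤_ (sym (size-x+^ ρ k)) (sym (size-x+^ ρ m)) (s≤s k≤m))

  paddedPower∈L : ∀ k → k ≤ m → pad n (t ^^ k) ∈ L
  paddedPower∈L k k≤m = ∈-polysOfLength⁺ n _ (length-paddedPower k k≤m)

  V⊆L : ∀ {v} → v ∈ V → v ∈ L
  V⊆L v∈V with ∈-paddedPowers⁻ ρ n (suc m) v∈V
  ... | k , s≤s k≤m , refl = paddedPower∈L k k≤m

  divisor⇔∈ : ∀ {c} → c ∈ L → Any (λ q → q ⊗ c ≈ a) L ⇔ c ∈ V
  divisor⇔∈ {c} c∈L = mk⇔ to from
    where
    to : Any (λ q → q ⊗ c ≈ a) L → c ∈ V
    to q∣a with find q∣a
    ... | q , _ , qc≈a with divisor-of-x+^ ρ m q c (mk≃ qc≈a)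
    ... | k , k≤m , c≃t^k = subst (_∈ V) (sym c≡pad) (∈-paddedPowers⁺ ρ n (suc m) k (s≤s k≤m))
      where
      c≡pad : c ≡ pad n (t ^^ k)
      c≡pad = ≃∧length⇒≡ c _
        (trans (∈-polysOfLength⁻ n c∈L) (sym (length-paddedPower k k≤m)))
        (≃-trans c≃t^k (≃-sym (pad-≃ n (t ^^ k))))
    from : c ∈ V → Any (λ q → q ⊗ c ≈ a) L
    from c∈V with ∈-paddedPowers⁻ ρ n (suc m) c∈V
    ... | k , s≤s k≤m , refl = lose (paddedPower∈L (m ∸ k) (m∸n≤m m k)) (≃⇒≈ (begin
      pad n (t ^^ (m ∸ k)) ⊗ pad n (t ^^ k) ≈⟨ ⊗-cong (pad-≃ n (t ^^ (m ∸ k))) (pad-≃ n (t ^^ k)) ⟩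
      t ^^ (m ∸ k) ⊗ t ^^ k                 ≈⟨ ^^-+ t (m ∸ k) k ⟩
      t ^^ (m ∸ k + k)                      ≡⟨ cong (t ^^_) (m∸n+n≡m k≤m) ⟩
      t ^^ m                                ∎))
      where open ≃-Reasoning

-- Stated for X and X+1 themselves: at a literal exponent Agda would otherwise compare
-- σ (x+ false ^^ 14) with σ (X ^^ 14) by running the enumeration inside σ.
σ-X^ : ∀ m → σ (X ^^ m) ≃ geometric X (suc m)
σ-X^ = σ-x+^ false

σ-X+1^ : ∀ m → σ (X+1 ^^ m) ≃ geometric X+1 (suc m)
σ-X+1^ = σ-x+^ true

σ-X^≈ : ∀ m q → geometric X (suc m) ≈ q → σ (X ^^ m) ≈ q
σ-X^≈ m q eq = ≃⇒≈ (≃-trans (σ-X^ m) (mk≃ {geometric X (suc m)} {q} eq))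

σ-X+1^≈ : ∀ m q → geometric X+1 (suc m) ≈ q → σ (X+1 ^^ m) ≈ q
σ-X+1^≈ m q eq = ≃⇒≈ (≃-trans (σ-X+1^ m) (mk≃ {geometric X+1 (suc m)} {q} eq))

-- Defs._∣_ restated over _≃_, again for the sake of inference.
infix 4 _∣ₚ_
record _∣ₚ_ (d a : Poly) : Set where
  constructor mk∣ₚ
  field
    cofactor : Poly
    cofactor-≃ : cofactor ⊗ d ≃ a

∣ₚ⇒∣ : ∀ {d a} → d ∣ₚ a → d ∣ a
∣ₚ⇒∣ (mk∣ₚ c cd≃a) = c , ≃⇒≈ cd≃a

∣⇒∣ₚ : ∀ d a → d ∣ a → d ∣ₚ a
∣⇒∣ₚ d a (c , cd≈a) = mk∣ₚ c (mk≃ cd≈a)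

∣ₚ-refl : ∀ p → p ∣ₚ p
∣ₚ-refl p = mk∣ₚ one (⊗-identityˡ p)

∣ₚ-trans : ∀ {r d a} → r ∣ₚ d → d ∣ₚ a → r ∣ₚ a
∣ₚ-trans {r} (mk∣ₚ c cr≃d) (mk∣ₚ c' c'd≃a) =
  mk∣ₚ (c' ⊗ c) (≃-trans (⊗-assoc c' c r) (≃-trans (⊗-congˡ c' cr≃d) c'd≃a))

∣ₚ-resp-≃ : ∀ {d a b} → a ≃ b → d ∣ₚ a → d ∣ₚ b
∣ₚ-resp-≃ a≃b (mk∣ₚ c cd≃a) = mk∣ₚ c (≃-trans cd≃a a≃b)

∣ₚ-⊕ : ∀ {d a b} → d ∣ₚ a → d ∣ₚ b → d ∣ₚ a ⊕ b
∣ₚ-⊕ {d} (mk∣ₚ c cd≃a) (mk∣ₚ c' c'd≃b) =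
  mk∣ₚ (c ⊕ c') (≃-trans (⊗-distribʳ c c' d) (⊕-cong cd≃a c'd≃b))

∣ₚ-⊗ : ∀ {d a} b → d ∣ₚ a → d ∣ₚ b ⊗ a
∣ₚ-⊗ {d} b (mk∣ₚ c cd≃a) = mk∣ₚ (b ⊗ c) (≃-trans (⊗-assoc b c d) (⊗-congˡ b cd≃a))

irreducible-∤-one : ∀ {r} → Irreducible r → ¬ r ∣ₚ one
irreducible-∤-one {r} (2≤r , _) (mk∣ₚ c cr≃one) =
  case ≤-trans 2≤r (≤-reflexive (size-cong (⊗≃one⇒≃one c r cr≃one))) of λ { (s≤s ()) }

size-proper-factor : ∀ a b → size a ≢ 1 → size b ≢ 1 → size (a ⊗ b) ≢ 0 →
                     2 ≤ size b × size b < size (a ⊗ b)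
size-proper-factor a b a≢1 b≢1 ab≢0 with size (a ⊗ b) in sab
... | zero  = ⊥-elim (ab≢0 refl)
... | suc k with size-factors a b sab
...   | i , j , sa , sb , k≡i+j =
  subst (2 ≤_) (sym sb) (s≤s (n≢0⇒n>0 λ j≡0 → b≢1 (trans sb (cong suc j≡0)))) ,
  subst₂ _<_ (sym sb) (cong suc (sym k≡i+j))
    (s≤s (m<n+m j (n≢0⇒n>0 λ i≡0 → a≢1 (trans sa (cong suc i≡0)))))

ProperDivisor : Poly → Poly → Set
ProperDivisor c d = 2 ≤ size d × size d < size c × Any (λ q → q ⊗ d ≈ c) (polysOfLength (size c))

properDivisor? : ∀ c d → Dec (ProperDivisor c d)
properDivisor? c d = (2 ≤? size d) ×-dec (size d <? size c) ×-dec divides? c d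

-- The search runs over all polynomials of length size c, so a factorisation of c into two
-- nonconstant factors would have produced a proper divisor there (in padded form).
irreducible-or-properDivisor : ∀ c → 2 ≤ size c →
  Irreducible c ⊎ Σ[ d ∈ Poly ] 2 ≤ size d × size d < size c × d ∣ₚ c
irreducible-or-properDivisor c 2≤c with any? (properDivisor? c) (polysOfLength (size c))
... | yes found with find found
...   | d , _ , 2≤d , d<c , d∣c with find d∣c
...     | q , _ , qd≈c = inj₂ (d , 2≤d , d<c , mk∣ₚ q (mk≃ qd≈c))
irreducible-or-properDivisor c 2≤c | no none = inj₁ (2≤c , split)
  where
  n = size c
  padded∈ : ∀ p → size p ≤ n → pad n p ∈ polysOfLength n
  padded∈ p p≤n = ∈-polysOfLength⁺ n (pad n p) (length-pad n p p≤n)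
  split : (a b : Poly) → a ⊗ b ≈ c → size a ≡ 1 ⊎ size b ≡ 1
  split a b ab≈c with size a ≟ 1 | size b ≟ 1
  ... | yes a≡1 | _       = inj₁ a≡1
  ... | no _    | yes b≡1 = inj₂ b≡1
  ... | no a≢1  | no b≢1  = ⊥-elim (none (lose (padded∈ b (<⇒≤ b<c))
        (subst (2 ≤_) (sym size-pad-b) 2≤b , subst (_< n) (sym size-pad-b) b<c ,
         lose (padded∈ a (<⇒≤ a<c)) (≃⇒≈ (≃-trans (⊗-cong (pad-≃ n a) (pad-≃ n b)) ab≃c)))))
    where
    ab≃c : a ⊗ b ≃ c
    ab≃c = mk≃ ab≈c
    size-ab : size (a ⊗ b) ≡ n
    size-ab = size-cong ab≃c
    ab≢0 : size (a ⊗ b) ≢ 0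
    ab≢0 eq = case ≤-trans 2≤c (≤-reflexive (trans (sym size-ab) eq)) of λ ()
    size-pad-b : size (pad n b) ≡ size b
    size-pad-b = size-cong (pad-≃ n b)
    2≤b = proj₁ (size-proper-factor a b a≢1 b≢1 ab≢0)
    b<c = subst (size b <_) size-ab (proj₂ (size-proper-factor a b a≢1 b≢1 ab≢0))
    a<c = subst (size a <_) (trans (size-cong (⊗-comm b a)) size-ab)
            (proj₂ (size-proper-factor b a b≢1 a≢1
                     (λ eq → ab≢0 (trans (size-cong (⊗-comm a b)) eq))))

irreducibleFactor : ∀ c → 2 ≤ size c → Σ[ r ∈ Poly ] Irreducible r × r ∣ₚ c
irreducibleFactor c = go (suc (size c)) c (s≤s ≤-refl)
  where
  go : ∀ bound c → size c < bound → 2 ≤ size c → Σ[ r ∈ Poly ] Irreducible r × r ∣ₚ c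
  go (suc bound) c (s≤s c≤bound) 2≤c with irreducible-or-properDivisor c 2≤c
  ... | inj₁ irreducible = c , irreducible , ∣ₚ-refl c
  ... | inj₂ (d , 2≤d , d<c , d∣c) with go bound d (<-≤-trans d<c c≤bound) 2≤d
  ...   | r , irreducible , r∣d = r , irreducible , ∣ₚ-trans r∣d d∣c

-- Repunits 1 + x + ⋯ + xⁿ⁻¹

repunit : ℕ → Poly
repunit n = replicate n true

X⊗ : ∀ s → X ⊗ s ≃ false ∷ s
X⊗ s = ∷-cong false (⊗-identityˡ s)

repunit-+ : ∀ d m → repunit (d + m) ≃ repunit d ⊕ X ^^ d ⊗ repunit m
repunit-+ zero    m = ≃-sym (⊗-identityˡ (repunit m))
repunit-+ (suc d) m = begin
  true ∷ repunit (d + m)                    ≈⟨ ∷-cong true (repunit-+ d m) ⟩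
  (true ∷ repunit d) ⊕ (false ∷ X ^^ d ⊗ r) ≈⟨ ⊕-congˡ (true ∷ repunit d) (X⊗ (X ^^ d ⊗ r)) ⟨
  (true ∷ repunit d) ⊕ X ⊗ (X ^^ d ⊗ r)     ≈⟨ ⊕-congˡ (true ∷ repunit d) (⊗-assoc X (X ^^ d) r) ⟨
  (true ∷ repunit d) ⊕ X ^^ suc d ⊗ r       ∎
  where
  open ≃-Reasoning
  r = repunit m

geometric-X : ∀ n → geometric X n ≃ repunit n
geometric-X zero    = ≃-refl
geometric-X (suc n) = begin
  X ^^ n ⊕ geometric X n            ≈⟨ ⊕-congˡ (X ^^ n) (geometric-X n) ⟩
  X ^^ n ⊕ repunit n                ≈⟨ ⊕-comm (X ^^ n) (repunit n) ⟩
  repunit n ⊕ X ^^ n                ≈⟨ ⊕-congˡ (repunit n) (⊗-identityʳ (X ^^ n)) ⟨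
  repunit n ⊕ X ^^ n ⊗ repunit 1    ≈⟨ repunit-+ n 1 ⟨
  repunit (n + 1)                   ≡⟨ cong repunit (+-comm n 1) ⟩
  repunit (suc n)                   ∎
  where open ≃-Reasoning

repunit∣repunit-* : ∀ d k → repunit d ∣ₚ repunit (k * d)
repunit∣repunit-* d zero    = mk∣ₚ [] ≃-refl
repunit∣repunit-* d (suc k) = ∣ₚ-resp-≃ (≃-sym (repunit-+ d (k * d)))
  (∣ₚ-⊕ (∣ₚ-refl (repunit d)) (∣ₚ-⊗ (X ^^ d) (repunit∣repunit-* d k)))

repunit-∣ : ∀ {d n} → d ∣ₙ n → repunit d ∣ₚ repunit n
repunit-∣ {d} (divides k refl) = repunit∣repunit-* d k

xⁿ+1 : ℕ → Poly
xⁿ+1 n = one ⊕ X ^^ n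

repunit⊗X+1 : ∀ n → repunit n ⊗ X+1 ≃ xⁿ+1 n
repunit⊗X+1 zero    = ≃-sym (⊕-self one)
repunit⊗X+1 (suc n) = begin
  (one ⊕ (false ∷ repunit n)) ⊗ X+1
    ≈⟨ ⊗-congʳ X+1 (⊕-congˡ one (X⊗ (repunit n))) ⟨
  (one ⊕ X ⊗ repunit n) ⊗ X+1
    ≈⟨ ⊗-distribʳ one (X ⊗ repunit n) X+1 ⟩
  one ⊗ X+1 ⊕ (X ⊗ repunit n) ⊗ X+1
    ≈⟨ ⊕-cong (⊗-identityˡ X+1) (⊗-assoc X (repunit n) X+1) ⟩
  (one ⊕ X) ⊕ X ⊗ (repunit n ⊗ X+1)
    ≈⟨ ⊕-congˡ (one ⊕ X) (⊗-congˡ X (repunit⊗X+1 n)) ⟩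
  (one ⊕ X) ⊕ X ⊗ (one ⊕ X ^^ n)
    ≈⟨ ⊕-congˡ (one ⊕ X) (⊗-distribˡ X one (X ^^ n)) ⟩
  (one ⊕ X) ⊕ (X ⊗ one ⊕ X ^^ suc n)
    ≈⟨ ⊕-congˡ (one ⊕ X) (⊕-congʳ (X ^^ suc n) (⊗-identityʳ X)) ⟩
  (one ⊕ X) ⊕ (X ⊕ X ^^ suc n)
    ≈⟨ ⊕-assoc one X (X ⊕ X ^^ suc n) ⟩
  one ⊕ (X ⊕ (X ⊕ X ^^ suc n))
    ≈⟨ ⊕-congˡ one (⊕-assoc X X (X ^^ suc n)) ⟨
  one ⊕ ((X ⊕ X) ⊕ X ^^ suc n)
    ≈⟨ ⊕-congˡ one (⊕-congʳ (X ^^ suc n) (⊕-self X)) ⟩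
  one ⊕ X ^^ suc n
    ∎
  where open ≃-Reasoning

xⁿ+1∣xⁿ+1-* : ∀ d k → xⁿ+1 d ∣ₚ xⁿ+1 (k * d)
xⁿ+1∣xⁿ+1-* d k with repunit∣repunit-* d k
... | mk∣ₚ c cr≃r' = mk∣ₚ c (begin
  c ⊗ xⁿ+1 d                  ≈⟨ ⊗-congˡ c (repunit⊗X+1 d) ⟨
  c ⊗ (repunit d ⊗ X+1)       ≈⟨ ⊗-assoc c (repunit d) X+1 ⟨
  (c ⊗ repunit d) ⊗ X+1       ≈⟨ ⊗-congʳ X+1 cr≃r' ⟩
  repunit (k * d) ⊗ X+1       ≈⟨ repunit⊗X+1 (k * d) ⟩
  xⁿ+1 (k * d)                ∎)
  where open ≃-Reasoning

consecutive⇒∣X+1 : ∀ {r} a → r ∣ₚ xⁿ+1 a → r ∣ₚ xⁿ+1 (suc a) → r ∣ₚ X+1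
consecutive⇒∣X+1 a r∣a r∣1+a = ∣ₚ-resp-≃ combination (∣ₚ-⊕ r∣1+a (∣ₚ-⊗ X r∣a))
  where
  open ≃-Reasoning
  combination : xⁿ+1 (suc a) ⊕ X ⊗ xⁿ+1 a ≃ X+1
  combination = begin
    (one ⊕ X ^^ suc a) ⊕ X ⊗ (one ⊕ X ^^ a)
      ≈⟨ ⊕-congˡ (one ⊕ X ^^ suc a) (⊗-distribˡ X one (X ^^ a)) ⟩
    (one ⊕ X ^^ suc a) ⊕ (X ⊗ one ⊕ X ^^ suc a)
      ≈⟨ ⊕-congˡ (one ⊕ X ^^ suc a) (⊕-congʳ (X ^^ suc a) (⊗-identityʳ X)) ⟩
    (one ⊕ X ^^ suc a) ⊕ (X ⊕ X ^^ suc a)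
      ≈⟨ interchange one (X ^^ suc a) X (X ^^ suc a) ⟩
    (one ⊕ X) ⊕ (X ^^ suc a ⊕ X ^^ suc a)
      ≈⟨ ⊕-congˡ (one ⊕ X) (⊕-self (X ^^ suc a)) ⟩
    (one ⊕ X) ⊕ []
      ≈⟨ ⊕-identityʳ (one ⊕ X) ⟩
    X+1
      ∎

∣xⁿ+1⇒∣xᵏⁿ+1 : ∀ {r} d k → r ∣ₚ xⁿ+1 d → r ∣ₚ xⁿ+1 (k * d)
∣xⁿ+1⇒∣xᵏⁿ+1 d k r∣d = ∣ₚ-trans r∣d (xⁿ+1∣xⁿ+1-* d k)

coprime⇒∣X+1 : ∀ {r p e} → Coprime p e → r ∣ₚ xⁿ+1 p → r ∣ₚ xⁿ+1 e → r ∣ₚ X+1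
coprime⇒∣X+1 {r} {p} {e} coprime r∣p r∣e with coprime-Bézout coprime
... | Bézout.+- i j 1+je≡ip = consecutive⇒∣X+1 (j * e) (∣xⁿ+1⇒∣xᵏⁿ+1 e j r∣e)
        (subst (λ n → r ∣ₚ xⁿ+1 n) (sym 1+je≡ip) (∣xⁿ+1⇒∣xᵏⁿ+1 p i r∣p))
... | Bézout.-+ i j 1+ip≡je = consecutive⇒∣X+1 (i * p) (∣xⁿ+1⇒∣xᵏⁿ+1 p i r∣p)
        (subst (λ n → r ∣ₚ xⁿ+1 n) (sym 1+ip≡je) (∣xⁿ+1⇒∣xᵏⁿ+1 e j r∣e))

eval-repunit-odd : ∀ n → ¬ 2 ∣ₙ n → eval true (repunit n) ≡ true
eval-repunit-odd zero          odd = ⊥-elim (odd (divides 0 refl))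
eval-repunit-odd (suc zero)    odd = refl
eval-repunit-odd (suc (suc n)) odd = trans (not-involutive (eval true (repunit n)))
  (eval-repunit-odd n λ { (divides k refl) → odd (divides (suc k) refl) })

-- An odd repunit is ≡ 1 mod x + 1, so its factors are coprime to x + 1.
irreducible-∣repunit⇒∤xⁿ+1 : ∀ {r p e} → ¬ 2 ∣ₙ p → Coprime p e → Irreducible r →
                             r ∣ₚ repunit p → ¬ r ∣ₚ xⁿ+1 e
irreducible-∣repunit⇒∤xⁿ+1 {r} {p} odd coprime irreducible r∣repunit r∣xᵉ+1 =
  irreducible-∤-one irreducible (∣ₚ-resp-≃ cancel (∣ₚ-⊕ r∣repunit r∣repunit+1))
  where
  repunit+1 = repunit p ⊕ one
  root : eval true repunit+1 ≡ false
  root = trans (eval-⊕ true (repunit p) one) (cong (_xor true) (eval-repunit-odd p odd))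
  X+1∣repunit+1 : X+1 ∣ₚ repunit+1
  X+1∣repunit+1 = mk∣ₚ (quotient true repunit+1)
    (≃-trans (⊗-comm (quotient true repunit+1) X+1) (≃-sym (factor-theorem true repunit+1 root)))
  r∣xᵖ+1 : r ∣ₚ xⁿ+1 p
  r∣xᵖ+1 = ∣ₚ-trans r∣repunit (mk∣ₚ X+1 (≃-trans (⊗-comm X+1 (repunit p)) (repunit⊗X+1 p)))
  r∣repunit+1 : r ∣ₚ repunit+1
  r∣repunit+1 = ∣ₚ-trans (coprime⇒∣X+1 coprime r∣xᵖ+1 r∣xᵉ+1) X+1∣repunit+1
  cancel : repunit p ⊕ repunit+1 ≃ one
  cancel = ≃-trans (≃-sym (⊕-assoc (repunit p) (repunit p) one)) (⊕-congʳ one (⊕-self (repunit p)))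

-- Certificates checked by evaluation

-- Wrapping T in a record keeps Agda from unfolding a check while comparing types; on
-- symbolic arguments that unfolding can take exponential space.
record Checked (b : Bool) : Set where
  constructor checked
  field holds : T b

decided : ∀ {A : Set} (a? : Dec A) → Checked (does a?) → A
decided (yes a) _           = a
decided (no _)  (checked ())

-- Long division and the extended Euclidean algorithm.  They are not verified: they only
-- propose witnesses, and every witness is checked before it is used.
divMod : Poly → Poly → Poly × Poly
divMod []      d = [] , []
divMod (a ∷ p) d with divMod p d | size d ∸ 1
... | q , r | deg = if coeff (a ∷ r) deg
                    then true ∷ q , take deg ((a ∷ r) ⊕ d)
                    else false ∷ q , take deg (a ∷ r)

_div_ _mod_ : Poly → Poly → Poly
a div d = proj₁ (divMod a d)
a mod d = proj₂ (divMod a d)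

bezout : ℕ → Poly → Poly → Poly × Poly
bezout zero    a b = one , []
bezout (suc n) a b with norm b
... | []     = one , []
... | c ∷ b' with bezout n (c ∷ b') (a mod (c ∷ b'))
...   | u , v = v , u ⊕ (a div (c ∷ b')) ⊗ v

DivisionExact : Poly → Poly → Set
DivisionExact d a = (a div d) ⊗ d ≈ a

divisionExact? : ∀ d a → Dec (DivisionExact d a)
divisionExact? d a = ((a div d) ⊗ d) ≈? a

divisionExact⇒∣ : ∀ d a → DivisionExact d a → d ∣ₚ a
divisionExact⇒∣ d a eq = mk∣ₚ (a div d) (mk≃ eq)

BézoutHolds : Poly → Poly → Set
BézoutHolds a b = let (u , v) = bezout (size a + size b) a b in u ⊗ a ⊕ v ⊗ b ≈ one

bézoutHolds? : ∀ a b → Dec (BézoutHolds a b)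
bézoutHolds? a b = let (u , v) = bezout (size a + size b) a b in (u ⊗ a ⊕ v ⊗ b) ≈? one

Coprimeₚ : Poly → Poly → Set
Coprimeₚ a b = ∀ {r} → r ∣ₚ a → r ∣ₚ b → r ∣ₚ one

bézoutHolds⇒coprime : ∀ a b → BézoutHolds a b → Coprimeₚ a b
bézoutHolds⇒coprime a b ua+vb≈one r∣a r∣b =
  ∣ₚ-resp-≃ (mk≃ ua+vb≈one) (∣ₚ-⊕ (∣ₚ-⊗ (proj₁ uv) r∣a) (∣ₚ-⊗ (proj₂ uv) r∣b))
  where uv = bezout (size a + size b) a b

divideOut : ℕ → Poly → Poly → Poly
divideOut zero    q a = a
divideOut (suc n) q a with norm (a mod q)
... | []    = divideOut n q (a div q)
... | _ ∷ _ = a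

𝓕-free : Poly → Poly
𝓕-free a = foldr (λ q b → divideOut (size b) q b) a 𝓕

record Obstruction (n : ℕ) : Set where
  field
    factor         : Poly
    nonconstant    : 2 ≤ size factor
    factor∣repunit : factor ∣ₚ repunit n
    coprime-𝓕      : All (Coprimeₚ factor) 𝓕

ObstructionChecks : ℕ → Poly → Set
ObstructionChecks n C = 2 ≤ size C × DivisionExact C (repunit n) × All (BézoutHolds C) 𝓕

obstructionChecks? : ∀ n C → Dec (ObstructionChecks n C)
obstructionChecks? n C =
  (2 ≤? size C) ×-dec divisionExact? C (repunit n) ×-dec all? (bézoutHolds? C) 𝓕

checked-obstruction : ∀ n C → ObstructionChecks n C → Obstruction n
checked-obstruction n C (2≤C , C∣repunit , bézout) = record
  { factor         = C
  ; nonconstant    = 2≤C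
  ; factor∣repunit = divisionExact⇒∣ C (repunit n) C∣repunit
  ; coprime-𝓕      = All.map (λ {q} → bézoutHolds⇒coprime C q) bézout
  }

obstruction : ∀ n → {Checked (does (obstructionChecks? n (𝓕-free (repunit n))))} → Obstruction n
obstruction n {ok} = checked-obstruction n (𝓕-free (repunit n))
  (decided (obstructionChecks? n (𝓕-free (repunit n))) ok)

module ℕₘ = Data.List.Membership.DecPropositional Data.Nat._≟_

exceptionalPrimes : List ℕ
exceptionalPrimes = 2 ∷ 3 ∷ 5 ∷ 7 ∷ 13 ∷ 17 ∷ 31 ∷ 73 ∷ 127 ∷ []

record Period (q : Poly) : Set where
  field
    exponentFactors : List ℕ
    exceptional     : All (_∈ exceptionalPrimes) exponentFactors
    divides-xᵉ+1    : q ∣ₚ xⁿ+1 (product exponentFactors)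

PeriodChecks : Poly → List ℕ → Set
PeriodChecks q fs = All (_∈ exceptionalPrimes) fs × DivisionExact q (xⁿ+1 (product fs))

periodChecks? : ∀ q fs → Dec (PeriodChecks q fs)
periodChecks? q fs = all? (ℕₘ._∈? exceptionalPrimes) fs ×-dec divisionExact? q (xⁿ+1 (product fs))

checked-period : ∀ q fs → PeriodChecks q fs → Period q
checked-period q fs (exceptional , q∣xᵉ+1) = record
  { exponentFactors = fs
  ; exceptional     = exceptional
  ; divides-xᵉ+1    = divisionExact⇒∣ q (xⁿ+1 (product fs)) q∣xᵉ+1
  }

period : ∀ {q} fs → {Checked (does (periodChecks? q fs))} → Period q
period {q} fs {ok} = checked-period q fs (decided (periodChecks? q fs) ok)

periods : All Period 𝓕
periods =
  period (3 ∷ []) ∷ period (7 ∷ []) ∷ period (7 ∷ []) ∷ period (5 ∷ []) ∷ period (3 ∷ 5 ∷ []) ∷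
  period (31 ∷ []) ∷ period (127 ∷ []) ∷ period (127 ∷ []) ∷ period (31 ∷ []) ∷
  period (127 ∷ []) ∷ period (127 ∷ []) ∷ period (73 ∷ []) ∷ period (73 ∷ []) ∷
  period (3 ∷ 5 ∷ []) ∷ period (3 ∷ 3 ∷ 7 ∷ []) ∷ period (13 ∷ []) ∷ period (3 ∷ 3 ∷ []) ∷
  period (3 ∷ 3 ∷ 7 ∷ []) ∷ period (3 ∷ 3 ∷ 7 ∷ 13 ∷ []) ∷ period (5 ∷ 17 ∷ []) ∷
  period (3 ∷ 5 ∷ 17 ∷ []) ∷ period (3 ∷ 3 ∷ 7 ∷ 13 ∷ []) ∷ period (127 ∷ []) ∷
  period (31 ∷ []) ∷ period (127 ∷ []) ∷ period (127 ∷ []) ∷ period (31 ∷ []) ∷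
  period (127 ∷ []) ∷ []

Good : ℕ → Set
Good n = FactorsIn 𝓕 (repunit n)

FactorsIn-resp-≃ : ∀ {a b} → a ≃ b → FactorsIn 𝓕 a → FactorsIn 𝓕 b
FactorsIn-resp-≃ {b = b} a≃b factors r irreducible r∣b =
  factors r irreducible (∣ₚ⇒∣ (∣ₚ-resp-≃ (≃-sym a≃b) (∣⇒∣ₚ r b r∣b)))

good-∣ : ∀ {m n} → m ∣ₙ n → Good n → Good m
good-∣ {m} m∣n good r irreducible r∣repunit =
  good r irreducible (∣ₚ⇒∣ (∣ₚ-trans (∣⇒∣ₚ r (repunit m) r∣repunit) (repunit-∣ m∣n)))

𝓕-factor : ∀ {n r} {P : Poly → Set} → Good n → All P 𝓕 → Irreducible r → r ∣ₚ repunit n →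
           Σ[ q ∈ Poly ] P q × r ∣ₚ q
𝓕-factor {n} {r} good all-P irreducible r∣repunit
  with All.lookupAny all-P (good r irreducible (∣ₚ⇒∣ r∣repunit))
... | Pq , r≈q = _ , Pq , mk∣ₚ one (≃-trans (⊗-identityˡ r) (mk≃ r≈q))

obstruction⇒¬good : ∀ {d n} → Obstruction d → d ∣ₙ n → ¬ Good n
obstruction⇒¬good obstruction d∣n good =
  let r , irreducible , r∣factor = irreducibleFactor factor nonconstant
      r∣repunit = ∣ₚ-trans r∣factor (∣ₚ-trans factor∣repunit (repunit-∣ d∣n))
      q , factor⊥q , r∣q = 𝓕-factor good coprime-𝓕 irreducible r∣repunit
  in irreducible-∤-one irreducible (factor⊥q r∣factor r∣q)
  where open Obstruction obstruction

¬good : ∀ d → {Checked (does (obstructionChecks? d (𝓕-free (repunit d))))} →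
        ∀ {n} → d ∣ₙ n → ¬ Good n
¬good d {ok} = obstruction⇒¬good (obstruction d {ok})

exceptionalPrimes-prime : All Prime exceptionalPrimes
exceptionalPrimes-prime = toWitness {a? = all? prime? exceptionalPrimes} _

∉exceptional⇒∤product : ∀ {p} fs → Prime p → p ∉ exceptionalPrimes →
                        All (_∈ exceptionalPrimes) fs → ¬ p ∣ₙ product fs
∉exceptional⇒∤product []       p-prime _  _ p∣1 = ¬prime[1] (subst Prime (∣1⇒≡1 p∣1) p-prime)
∉exceptional⇒∤product (f ∷ fs) p-prime p∉ (f∈ ∷ fs∈) p∣f*fs
  with euclidsLemma f (product fs) p-prime p∣f*fs
... | inj₂ p∣fs = ∉exceptional⇒∤product fs p-prime p∉ fs∈ p∣fs
... | inj₁ p∣f with prime⇒irreducible (All.lookup exceptionalPrimes-prime f∈) p∣f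
...   | inj₁ p≡1 = ¬prime[1] (subst Prime p≡1 p-prime)
...   | inj₂ p≡f = p∉ (subst (_∈ exceptionalPrimes) (sym p≡f) f∈)

prime∤⇒coprime : ∀ {p n} → Prime p → ¬ p ∣ₙ n → Coprime p n
prime∤⇒coprime p-prime p∤n (d∣p , d∣n) with prime⇒irreducible p-prime d∣p
... | inj₁ d≡1 = d≡1
... | inj₂ refl = ⊥-elim (p∤n d∣n)

size-repunit : ∀ n → size (repunit n) ≡ n
size-repunit n = trans (cong length (norm-repunit n)) (length-replicate n)
  where
  norm-repunit : ∀ n → norm (repunit n) ≡ repunit n
  norm-repunit zero          = refl
  norm-repunit (suc zero)    = refl
  norm-repunit (suc (suc n)) =
    trans (norm-∷ true (repunit (suc n))) (cong (normCons true) (norm-repunit (suc n)))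

unexceptional⇒¬good : ∀ {p n} → Prime p → p ∉ exceptionalPrimes → p ∣ₙ n → ¬ Good n
unexceptional⇒¬good {p} p-prime p∉ p∣n good =
  let r , irreducible , r∣repunit = irreducibleFactor (repunit p) 2≤size
      q , period , r∣q = 𝓕-factor good periods irreducible (∣ₚ-trans r∣repunit (repunit-∣ p∣n))
      open Period period
      p∤e = ∉exceptional⇒∤product exponentFactors p-prime p∉ exceptional
      coprime = prime∤⇒coprime p-prime p∤e
  in irreducible-∣repunit⇒∤xⁿ+1 odd coprime irreducible r∣repunit (∣ₚ-trans r∣q divides-xᵉ+1)
  where
  prime⇒≥2 : ∀ {p} → Prime p → 2 ≤ p
  prime⇒≥2 {suc (suc _)} _ = s≤s (s≤s z≤n)
  prime⇒≥2 {1} p-prime = ⊥-elim (¬prime[1] p-prime)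
  prime⇒≥2 {0} p-prime = ⊥-elim (¬prime[0] p-prime)
  2≤size : 2 ≤ size (repunit p)
  2≤size = subst (2 ≤_) (sym (size-repunit p)) (prime⇒≥2 p-prime)
  odd : ¬ 2 ∣ₙ p
  odd 2∣p with prime⇒irreducible p-prime 2∣p
  ... | inj₂ refl = p∉ (here refl)

data AdmissiblePrime : ℕ → Set where
  prime3 : AdmissiblePrime 3
  prime5 : AdmissiblePrime 5
  prime7 : AdmissiblePrime 7
  prime13 : AdmissiblePrime 13

data Admissible : ℕ → Set where
  adm1 : Admissible 1
  adm3 : Admissible 3
  adm5 : Admissible 5
  adm7 : Admissible 7
  adm9 : Admissible 9
  adm13 : Admissible 13
  adm15 : Admissible 15

good-prime : ∀ {p n} → Prime p → p ∣ₙ n → Good n → AdmissiblePrime p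
good-prime {p} p-prime p∣n good with p ℕₘ.∈? exceptionalPrimes
... | no p∉ = ⊥-elim (unexceptional⇒¬good p-prime p∉ p∣n good)
... | yes (here refl)                                                 = ⊥-elim (¬good 2 p∣n good)
... | yes (there (here refl))                                         = prime3
... | yes (there (there (here refl)))                                 = prime5
... | yes (there (there (there (here refl))))                         = prime7
... | yes (there (there (there (there (here refl)))))                 = prime13
... | yes (there (there (there (there (there (here refl))))))         = ⊥-elim (¬good 17 p∣n good)
... | yes (there (there (there (there (there (there (here refl))))))) = ⊥-elim (¬good 31 p∣n good)
... | yes (there (there (there (there (there (there (there (here refl)))))))) =
  ⊥-elim (¬good 73 p∣n good)
... | yes (there (there (there (there (there (there (there (there (here refl))))))))) =
  ⊥-elim (¬good 127 p∣n good)

extend : ∀ {p m} → AdmissiblePrime p → Admissible m → Good (p * m) → Admissible (p * m)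
extend prime3  adm1  good = adm3
extend prime5  adm1  good = adm5
extend prime7  adm1  good = adm7
extend prime13 adm1  good = adm13
extend prime3  adm3  good = adm9
extend prime5  adm3  good = adm15
extend prime7  adm3  good = ⊥-elim (¬good 21 (divides 1 refl) good)
extend prime13 adm3  good = ⊥-elim (¬good 39 (divides 1 refl) good)
extend prime3  adm5  good = adm15
extend prime5  adm5  good = ⊥-elim (¬good 25 (divides 1 refl) good)
extend prime7  adm5  good = ⊥-elim (¬good 35 (divides 1 refl) good)
extend prime13 adm5  good = ⊥-elim (¬good 65 (divides 1 refl) good)
extend prime3  adm7  good = ⊥-elim (¬good 21 (divides 1 refl) good)
extend prime5  adm7  good = ⊥-elim (¬good 35 (divides 1 refl) good)
extend prime7  adm7  good = ⊥-elim (¬good 49 (divides 1 refl) good)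
extend prime13 adm7  good = ⊥-elim (¬good 91 (divides 1 refl) good)
extend prime3  adm9  good = ⊥-elim (¬good 27 (divides 1 refl) good)
extend prime5  adm9  good = ⊥-elim (¬good 45 (divides 1 refl) good)
extend prime7  adm9  good = ⊥-elim (¬good 21 (divides 3 refl) good)
extend prime13 adm9  good = ⊥-elim (¬good 39 (divides 3 refl) good)
extend prime3  adm13 good = ⊥-elim (¬good 39 (divides 1 refl) good)
extend prime5  adm13 good = ⊥-elim (¬good 65 (divides 1 refl) good)
extend prime7  adm13 good = ⊥-elim (¬good 91 (divides 1 refl) good)
extend prime13 adm13 good = ⊥-elim (¬good 169 (divides 1 refl) good)
extend prime3  adm15 good = ⊥-elim (¬good 45 (divides 1 refl) good)
extend prime5  adm15 good = ⊥-elim (¬good 25 (divides 3 refl) good)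
extend prime7  adm15 good = ⊥-elim (¬good 21 (divides 5 refl) good)
extend prime13 adm15 good = ⊥-elim (¬good 39 (divides 5 refl) good)

good⇒admissible-product : ∀ fs → All Prime fs → Good (product fs) → Admissible (product fs)
good⇒admissible-product []       []             good = adm1
good⇒admissible-product (p ∷ ps) (p-prime ∷ ps-prime) good =
  extend (good-prime p-prime (m∣m*n (product ps)) good)
         (good⇒admissible-product ps ps-prime (good-∣ (n∣m*n p) good))
         good

good⇒admissible : ∀ n → Good (suc n) → Admissible (suc n)
good⇒admissible n good =
  subst Admissible (sym isFactorisation)
    (good⇒admissible-product factors factorsPrime (subst Good isFactorisation good))
  where open PrimeFactorisation (factorise (suc n))

odd-injective : ∀ {h k} → suc (2 * k) ≡ suc (2 * h) → h ≡ k
odd-injective {h} {k} eq = *-cancelˡ-≡ h k 2 (sym (suc-injective eq))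

admissible-odd : ∀ {n h} → n ≡ suc (2 * h) → 1 ≤ h → Admissible n →
                 (h ≡ 1) ⊎ (h ≡ 2) ⊎ (h ≡ 3) ⊎ (h ≡ 4) ⊎ (h ≡ 6) ⊎ (h ≡ 7)
admissible-odd {h = suc h} eq _ adm1 = case suc-injective eq of λ ()
admissible-odd eq _ adm3  = inj₁ (odd-injective eq)
admissible-odd eq _ adm5  = inj₂ (inj₁ (odd-injective eq))
admissible-odd eq _ adm7  = inj₂ (inj₂ (inj₁ (odd-injective eq)))
admissible-odd eq _ adm9  = inj₂ (inj₂ (inj₂ (inj₁ (odd-injective eq))))
admissible-odd eq _ adm13 = inj₂ (inj₂ (inj₂ (inj₂ (inj₁ (odd-injective eq)))))
admissible-odd eq _ adm15 = inj₂ (inj₂ (inj₂ (inj₂ (inj₂ (odd-injective eq)))))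

lemma3p25 : (h : ℕ) → 1 ≤ h →
    FactorsIn 𝓕 (σ (X ^^ (2 * h))) → FactorsIn 𝓕 (σ (X+1 ^^ (2 * h))) →
    ((h ≡ 1) ⊎ (h ≡ 2) ⊎ (h ≡ 3) ⊎ (h ≡ 4) ⊎ (h ≡ 6) ⊎ (h ≡ 7))
    × (σ (X ^^ 2) ≈ M1) × (σ (X+1 ^^ 2) ≈ M1)
    × (σ (X ^^ 4) ≈ M4) × (σ (X+1 ^^ 4) ≈ M5)
    × (σ (X ^^ 6) ≈ M2 ⊗ M3) × (σ (X+1 ^^ 6) ≈ M2 ⊗ M3)
    × (σ (X ^^ 8) ≈ M1 ⊗ S4) × (σ (X+1 ^^ 8) ≈ M1 ⊗ S5)
    × (σ (X ^^ 12) ≈ S3) × (σ (X+1 ^^ 12) ≈ S6)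
    × (σ (X ^^ 14) ≈ M1 ⊗ M4 ⊗ M5 ⊗ S1) × (σ (X+1 ^^ 14) ≈ M1 ⊗ M4 ⊗ M5 ⊗ S1)
lemma3p25 h 1≤h σ[x²ʰ]-factors _ =
  admissible-odd refl 1≤h (good⇒admissible (2 * h) good) ,
  σ-X^≈ 2  M1 refl                  , σ-X+1^≈ 2  M1 refl ,
  σ-X^≈ 4  M4 refl                  , σ-X+1^≈ 4  M5 refl ,
  σ-X^≈ 6  (M2 ⊗ M3) refl           , σ-X+1^≈ 6  (M2 ⊗ M3) refl ,
  σ-X^≈ 8  (M1 ⊗ S4) refl           , σ-X+1^≈ 8  (M1 ⊗ S5) refl ,
  σ-X^≈ 12 S3 refl                  , σ-X+1^≈ 12 S6 refl ,
  σ-X^≈ 14 (M1 ⊗ M4 ⊗ M5 ⊗ S1) refl , σ-X+1^≈ 14 (M1 ⊗ M4 ⊗ M5 ⊗ S1) refl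
  where
  good : Good (suc (2 * h))
  good = FactorsIn-resp-≃ (≃-trans (σ-X^ (2 * h)) (geometric-X (suc (2 * h)))) σ[x²ʰ]-factors
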